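{- Let $n\ge4$, $i\in\{1,2\}$, $m\ge1$ and $A=(a_{p,q})\in B^{i,m}$ (with $a_{2,q}:=0$ if $i=1$). Define $\Sigma_n:=-a_{2,n}$, $\chi_n:=1$, and recursively for $k=n-1,n-2,\dots,2$: $\Sigma_k:=a_{1,k+1}+(1-\chi_{k+1})\Sigma_{k+1}-a_{2,k}$, $\chi_k:=1$ if $\Sigma_k<0$ and $\chi_k:=0$ if $\Sigma_k\ge0$. With the operators $X_\ell$ ($2\le\ell\le n$) and $G$ defined as follows: $c_\ell=\sum_{p=1}^i a_{p,\ell}$, $X_\ell=(f_\ell^{c_\ell}\circ f_{\ell-1}^{c_\ell}\circ\cdots\circ f_{i+1}^{c_\ell})\circ D_\ell$ where $D_\ell=f_2^{a_{2,\ell}}$ if $i=2$ and $D_\ell=\mathrm{id}$ if $i=1$, and $G=f_1^{d}\circ\cdots\circ f_i^{d}$ with $d=\sum_{r=i}^n a_{1,r}$, let for $2\le k\le n$ $$T^{(k)}:=X_k\circ X_{k+1}\circ\cdots\circ X_n\circ G\,(T^{(0)})\in\mathrm{SSYT}(m\omega_i),$$ the operators acting on tableaux. Then these tableaux are defined and, in matrix notation, $T^{(k)}_{s,t}$ equals: - $m-\sum_{j=i}^n a_{1,j}$ if $(s,t)=(i-1,1)$; - $\sum_{j=2}^k a_{1,j}+(1-\chi_k)\Sigma_k$ if $(s,t)=(i-1,2)$; - $m-\sum_{j=i}^n a_{1,j}+\sum_{j=k}^n\chi_j\Sigma_j$ if $(s,t)=(i,1)$; - $\sum_{j=i}^{k-1}a_{1,j}$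 if $(s,t)=(i,2)$ and $k\ge i+1$; - $a_{2,t-1}+\chi_{t-1}\Sigma_{t-1}$ if $s=i-1$ and $k+1\le t\le n$; - $a_{1,t+i-2}-\chi_{t+i-2}\Sigma_{t+i-2}$ if $s=i$ and $k-i+2\le t\le n-i+2$; - $0$ for all other $(s,t)$, (cases with $s=i-1$ being vacuous when $i=1$). In particular $\varphi_{i,m}(A)=T^{(2)}$.
   Context: $B^{i,m}$ is the set of arrays $A=(a_{p,q})$ of non-negative integers indexed by $1\le p\le i$ (column index), $i\le q\le n$ (row index), with $\sum_{r=1}^n a_{\beta(r)}\le m$ for every Dyck path $\beta$ (positions $\beta(1)=(1,i),\dots,\beta(n)=(i,n)$ with $\beta(r+1)\in\{(a,b+1),(a+1,b)\}$ if $\beta(r)=(a,b)$); $a_{p,q}=0$ outside this range. It carries a crystal structure (Kus's polytope model of the Kirillov–Reshetikhin crystal; the zero array is its highest weight element). $\mathrm{SSYT}(m\omega_i)$: semistandard Young tableaux of rectangular shape with $i$ rows and $m$ columns, entries in $\{1,\dots,n+1\}$; row $s$ has entries in $[s,n-i+s+1]$. Crystal operators on tableaux, $1\le j\le n$: read the tableau left to right along rows, starting with the bottom row and moving up; ignoring letters other than $j,j+1$, repeatedly cancel a letter $j+1$ immediately followed by a letter $j$ until the remaining letters are $j^a(j+1)^b$; $f_j$ changes the rightmost unpaired $j$ to $j+1$ (undefined if $a=0$), $e_j$ changes the leftmost unpaired $j+1$ to $j$. $f_j^c$ means $c$-fold application, $\circ$ is applied right to left. $T^{(0)}$ is the tableau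 whose row $s$ has all entries $s$. Matrix notation: for a tableau $T$, $T_{s,t}$ ($1\le s\le i$, $1\le t\le n-i+2$) is the number of entries equal to $s+t-1$ in row $s$ of $T$. $\varphi_{i,m}:B^{i,m}\to\mathrm{SSYT}(m\omega_i)$ is the crystal isomorphism (the unique bijection commuting with all $f_j,e_j$, $1\le j\le n$; it also respects the affine crystal structures), sending the zero array to $T^{(0)}$; on $B^{i,m}$ the operators $f_j$ are those of the polytope model, under which $P:=X_2\circ\cdots\circ X_n\circ G$ sends the zero array to $A$. -}

module Defs where

open import Data.Nat using (ℕ; zero; suc; _+_; _∸_; _≤_; _<_; _≡ᵇ_)
open import Data.Integer as Z using (ℤ; +_; -[1+_])
open import Data.List using (List; []; _∷_; concat; reverse; take; drop; map; length; applyUpTo; replicate; filterᵇ; last)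
open import Data.Maybe using (Maybe; just; nothing; _>>=_)
open import Data.Product using (_×_; _,_; proj₁; proj₂)
open import Data.Sum using (_⊎_)
open import Data.List.Relation.Unary.All using (All)
open import Relation.Binary.PropositionalEquality using (_≡_)
import Data.Bool
open import Data.Nat.ListAction using (sum)
import Data.Empty

-- Arrays A = (a_{p,q}) are functions ℕ → ℕ → ℕ (column p, row q),
-- required to vanish outside 1 ≤ p ≤ i, i ≤ q ≤ n.

Array : Set
Array = ℕ → ℕ → ℕ

data Step : ℕ × ℕ → ℕ × ℕ → Set where
  down  : ∀ {a b} → Step (a , b) (a , suc b)
  right : ∀ {a b} → Step (a , b) (suc a , b)

data Path : ℕ × ℕ → ℕ × ℕ → Set where
  stop : ∀ {x} → Path x x
  _∷_  : ∀ {x y z} → Step x y → Path y z → Path x z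

pathSum : Array → ∀ {x y} → Path x y → ℕ
pathSum A {x = p , q} stop     = A p q
pathSum A {x = p , q} (_ ∷ β)  = A p q + pathSum A β

DyckPath : ℕ → ℕ → Set
DyckPath i n = Path (1 , i) (i , n)

InB : (i n m : ℕ) → Array → Set
InB i n m A =
  (∀ p q → (p ≡ 0 ⊎ i < p ⊎ q < i ⊎ n < q) → A p q ≡ 0)
  × (∀ (β : DyckPath i n) → pathSum A β ≤ m)

-- Tableaux: list of rows (top row first), each row a list of entries.

Tableau : Set
Tableau = List (List ℕ)

nth : {X : Set} → X → List X → ℕ → X
nth d []       _       = d
nth d (x ∷ xs) zero    = x
nth d (x ∷ xs) (suc k) = nth d xs k

-- entry in (0-based) row s, column c
ent : Tableau → ℕ → ℕ → ℕ
ent T s c = nth 0 (nth [] T s) c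

IsSSYT : (i n m : ℕ) → Tableau → Set
IsSSYT i n m T =
  length T ≡ i
  × All (λ r → length r ≡ m) T
  × (∀ s c → s < i → suc c < m → ent T s c ≤ ent T s (suc c))
  × (∀ s c → suc s < i → c < m → ent T s c < ent T (suc s) c)
  × (∀ s c → s < i → c < m → 1 ≤ ent T s c × ent T s c ≤ suc n)

T0 : (i m : ℕ) → Tableau
T0 i m = applyUpTo (λ r → replicate m (suc r)) i

readWord : Tableau → List ℕ
readWord T = concat (reverse T)

-- positions (0-based) of the unpaired letters j in a word, in order.
-- o = number of currently uncancelled letters j+1 to the left.
unpaired : (j o pos : ℕ) → List ℕ → List ℕ
unpaired j o p [] = []
unpaired j o p (x ∷ w) with x ≡ᵇ j | x ≡ᵇ suc j
... | Data.Bool.true | _ with o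
...   | zero   = p ∷ unpaired j zero (suc p) w
...   | suc o' = unpaired j o' (suc p) w
unpaired j o p (x ∷ w) | Data.Bool.false | Data.Bool.true  = unpaired j (suc o) (suc p) w
unpaired j o p (x ∷ w) | Data.Bool.false | Data.Bool.false = unpaired j o (suc p) w

setAt : List ℕ → ℕ → ℕ → List ℕ
setAt []       _       v = []
setAt (x ∷ xs) zero    v = v ∷ xs
setAt (x ∷ xs) (suc k) v = x ∷ setAt xs k v

fWord : ℕ → List ℕ → Maybe (List ℕ)
fWord j w with last (unpaired j 0 0 w)
... | nothing = nothing
... | just p  = just (setAt w p (suc j))

chunk : List ℕ → List ℕ → List (List ℕ)
chunk []       w = []
chunk (l ∷ ls) w = take l w ∷ chunk ls (drop l w)

fT : ℕ → Tableau → Maybe Tableau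
fT j T with fWord j (readWord T)
... | nothing = nothing
... | just w  = just (reverse (chunk (map length (reverse T)) w))

fPow : ℕ → ℕ → Tableau → Maybe Tableau
fPow j zero    T = just T
fPow j (suc c) T = fPow j c T >>= fT j

applyAll : List (Tableau → Maybe Tableau) → Tableau → Maybe Tableau
applyAll []       T = just T
applyAll (g ∷ gs) T = g T >>= applyAll gs

fromTo : ℕ → ℕ → List ℕ
fromTo lo hi = applyUpTo (λ x → lo + x) (suc hi ∸ lo)

sumN : ℕ → ℕ → (ℕ → ℕ) → ℕ
sumN lo hi f = sum (map f (fromTo lo hi))

sumZ : ℕ → ℕ → (ℕ → ℤ) → ℤ
sumZ lo hi f = Data.List.foldr Z._+_ (+ 0) (map f (fromTo lo hi))

cc : (i : ℕ) → Array → ℕ → ℕ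
cc i A ℓ = sumN 1 i (λ p → A p ℓ)

Dop : (i : ℕ) → Array → ℕ → Tableau → Maybe Tableau
Dop 2 A ℓ = fPow 2 (A 2 ℓ)
Dop _ A ℓ = just

-- X_ℓ = f_ℓ^{c} ∘ f_{ℓ-1}^{c} ∘ ⋯ ∘ f_{i+1}^{c} ∘ D_ℓ   (D_ℓ applied first)
Xop : (i : ℕ) → Array → ℕ → Tableau → Maybe Tableau
Xop i A ℓ = applyAll (Dop i A ℓ ∷ map (λ j → fPow j (cc i A ℓ)) (fromTo (suc i) ℓ))

-- d = Σ_{r=i}^{n} a_{1,r};  G = f_1^d ∘ ⋯ ∘ f_i^d  (f_i^d applied first)
Gop : (i n : ℕ) → Array → Tableau → Maybe Tableau
Gop i n A = applyAll (map (λ j → fPow j (sumN i n (λ r → A 1 r))) (reverse (fromTo 1 i)))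

Tk : (i n m : ℕ) → Array → ℕ → Maybe Tableau
Tk i n m A k = applyAll (Gop i n A ∷ map (Xop i A) (reverse (fromTo k n))) (T0 i m)

-- matrix notation: T_{s,t} = number of entries s+t-1 in row s (1-based)
count : ℕ → List ℕ → ℕ
count v r = length (filterᵇ (λ x → x ≡ᵇ v) r)

mat : Tableau → ℕ → ℕ → ℕ
mat T s t = count (s + t ∸ 1) (nth [] T (s ∸ 1))

chi : ℤ → ℤ
chi (+ _)    = + 0
chi -[1+ _ ] = + 1

-- SC d = (Σ_{n-d} , χ_{n-d})
SC : Array → (n : ℕ) → ℕ → ℤ × ℤ
SC A n zero = (Z.- (+ A 2 n) , + 1)
SC A n (suc d) =
  let s = proj₁ (SC A n d)
      c = proj₂ (SC A n d)
      k = n ∸ suc d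
      s' = (+ A 1 (suc k) Z.+ (+ 1 Z.- c) Z.* s) Z.- + A 2 k
  in (s' , chi s')

Sig : Array → (n k : ℕ) → ℤ
Sig A n k = proj₁ (SC A n (n ∸ k))

Chi : Array → (n k : ℕ) → ℤ
Chi A n k = proj₂ (SC A n (n ∸ k))

InDom : (i n s t : ℕ) → Set
InDom i n s t = 1 ≤ s × s ≤ i × 1 ≤ t × t ≤ n ∸ i + 2

Case1 Case2 Case3 Case4 Case5 Case6 : (i n k s t : ℕ) → Set
Case1 i n k s t = s ≡ i ∸ 1 × t ≡ 1
Case2 i n k s t = s ≡ i ∸ 1 × t ≡ 2
Case3 i n k s t = s ≡ i × t ≡ 1
Case4 i n k s t = s ≡ i × t ≡ 2 × i + 1 ≤ k
Case5 i n k s t = s ≡ i ∸ 1 × k + 1 ≤ t × t ≤ n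
Case6 i n k s t = s ≡ i × k + 2 ∸ i ≤ t × t ≤ n + 2 ∸ i

MatrixFormula : (i n m : ℕ) → Array → (k : ℕ) → Tableau → Set
MatrixFormula i n m A k T =
  (∀ s t → InDom i n s t → Case1 i n k s t →
     + mat T s t ≡ + m Z.- + sumN i n (λ j → A 1 j))
  × (∀ s t → InDom i n s t → Case2 i n k s t →
     + mat T s t ≡ + sumN 2 k (λ j → A 1 j) Z.+ (+ 1 Z.- Chi A n k) Z.* Sig A n k)
  × (∀ s t → InDom i n s t → Case3 i n k s t →
     + mat T s t ≡ (+ m Z.- + sumN i n (λ j → A 1 j)) Z.+ sumZ k n (λ j → Chi A n j Z.* Sig A n j))
  × (∀ s t → InDom i n s t → Case4 i n k s t →
     + mat T s t ≡ + sumN i (k ∸ 1) (λ j → A 1 j))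
  × (∀ s t → InDom i n s t → Case5 i n k s t →
     + mat T s t ≡ + A 2 (t ∸ 1) Z.+ Chi A n (t ∸ 1) Z.* Sig A n (t ∸ 1))
  × (∀ s t → InDom i n s t → Case6 i n k s t →
     + mat T s t ≡ + A 1 (t + i ∸ 2) Z.- Chi A n (t + i ∸ 2) Z.* Sig A n (t + i ∸ 2))
  × (∀ s t → InDom i n s t →
     ¬' (Case1 i n k s t ⊎ Case2 i n k s t ⊎ Case3 i n k s t
         ⊎ Case4 i n k s t ⊎ Case5 i n k s t ⊎ Case6 i n k s t) →
     mat T s t ≡ 0)
  where
  ¬' : Set → Set
  ¬' P = P → Data.Empty.⊥

-- The tableaux T^(k) are computed explicitly, from T^(n+1) = G(T^(0)) down to
-- T^(k). Rows are kept in block form pre ++ j^a ++ (j+1)^b ++ post with pre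
-- below j and post above j+1; there the signature rule is transparent: the
-- letters j+1 of the bottom row cancel the first letters j of the top row, so
-- f_j raises the last j of the top row while it has unpaired ones, and
-- afterwards the last j of the bottom row. For i = 2, D_k = f_2^(a_{2,k})
-- therefore splits into ν_k = max(-Σ_k, 0) raisings in the bottom row and the
-- remaining ones in the top row, and f_3^c, ..., f_k^c carry the two new
-- blocks of 3s up to k+1. The Dyck path bounds give
-- Σ_{j≤n} a_{1,j} + Σ_{j≥k} ν_j ≤ m, which keeps every block length nonnegative. Column strictness is
-- carried along as a counting inequality that the raisings preserve, and the
-- matrix entries are read off by counting letters in the explicit rows.
module Submission where

open import Defs
open import Data.Bool using (true; false; T)
open import Data.Empty using (⊥; ⊥-elim)
open import Data.List
  using (List; []; _∷_; _++_; _∷ʳ_; length; replicate; last; map; reverse; concat; take; drop; filter; applyUpTo; foldr)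
open import Data.List.Properties
  using (∷-injective; ++-assoc; ++-identityʳ; length-++; length-replicate; length-take; length-drop; map-++; map-cong;
         reverse-involutive; reverse-map; unfold-reverse; applyUpTo-∷ʳ; filter-++; filter-all; filter-none; filter-accept; filter-reject)
open import Data.List.Relation.Unary.All as All using (All; []; _∷_)
open import Data.List.Relation.Unary.All.Properties using (++⁺; map⁺)
open import Data.Maybe using (Maybe; just; nothing; _>>=_)
open import Data.Nat
  using (ℕ; zero; suc; pred; _+_; _∸_; _≤_; _<_; _≤‴_; _≤?_; _<?_; _≟_; _≡ᵇ_; z≤n; s≤s; ≤‴-refl; ≤‴-step)
open import Data.Nat.ListAction using (sum)
open import Data.Nat.ListAction.Properties using (sum-++)
open import Data.Nat.Properties
open import Data.Nat.Tactic.RingSolver using (solve-∀)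
open import Data.Product using (_×_; _,_; proj₁; proj₂; ∃)
open import Data.Sum using (_⊎_; inj₁; inj₂)
open import Data.Unit using (⊤; tt)
open import Function using (_∘_)
open import Relation.Binary.PropositionalEquality
open import Relation.Nullary using (yes; no; ¬_)
open import Relation.Nullary.Decidable using (T?)

open import Algebra.Properties.CommutativeSemigroup +-commutativeSemigroup using (x∙yz≈y∙xz)

-- The signature rule

≢⇒≡ᵇ-false : ∀ {x y} → x ≢ y → (x ≡ᵇ y) ≡ false
≢⇒≡ᵇ-false {x} {y} x≢y with x ≡ᵇ y in eq
... | false = refl
... | true  = ⊥-elim (x≢y (≡ᵇ⇒≡ x y (subst T (sym eq) _)))

≡ᵇ-refl : ∀ x → (x ≡ᵇ x) ≡ true
≡ᵇ-refl zero    = refl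
≡ᵇ-refl (suc x) = ≡ᵇ-refl x

-- Reading j+1 as an opening and j as a closing bracket, `unpaired j o p w` lists
-- (counting from p) the positions of the unmatched closing brackets of w when o
-- brackets are already open; openAfter j o w is the number still open after w.
openAfter : ℕ → ℕ → List ℕ → ℕ
openAfter j o []      = o
openAfter j o (x ∷ w) with x ≡ᵇ j | x ≡ᵇ suc j
... | true  | _     = openAfter j (pred o) w
... | false | true  = openAfter j (suc o) w
... | false | false = openAfter j o w

unpaired-++ : ∀ j o p xs ys →
  unpaired j o p (xs ++ ys) ≡ unpaired j o p xs ++ unpaired j (openAfter j o xs) (p + length xs) ys
unpaired-++ j o p []       ys rewrite +-identityʳ p = refl
unpaired-++ j o p (x ∷ xs) ys rewrite +-suc p (length xs) with x ≡ᵇ j | x ≡ᵇ suc j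
... | true  | _ with o
...   | zero  = cong (p ∷_) (unpaired-++ j 0 (suc p) xs ys)
...   | suc o = unpaired-++ j o (suc p) xs ys
unpaired-++ j o p (x ∷ xs) ys | false | true  = unpaired-++ j (suc o) (suc p) xs ys
unpaired-++ j o p (x ∷ xs) ys | false | false = unpaired-++ j o (suc p) xs ys

openAfter-++ : ∀ j o xs ys → openAfter j o (xs ++ ys) ≡ openAfter j (openAfter j o xs) ys
openAfter-++ j o []       ys = refl
openAfter-++ j o (x ∷ xs) ys with x ≡ᵇ j | x ≡ᵇ suc j
... | true  | _     = openAfter-++ j (pred o) xs ys
... | false | true  = openAfter-++ j (suc o) xs ys
... | false | false = openAfter-++ j o xs ys

Avoids : ℕ → List ℕ → Set
Avoids j = All (λ x → x ≢ j × x ≢ suc j)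

unpaired-avoiding : ∀ {j w} o p → Avoids j w → unpaired j o p w ≡ []
unpaired-avoiding o p [] = refl
unpaired-avoiding o p ((x≢j , x≢1+j) ∷ av) rewrite ≢⇒≡ᵇ-false x≢j | ≢⇒≡ᵇ-false x≢1+j =
  unpaired-avoiding o (suc p) av

openAfter-avoiding : ∀ {j w} o → Avoids j w → openAfter j o w ≡ o
openAfter-avoiding o [] = refl
openAfter-avoiding o ((x≢j , x≢1+j) ∷ av) rewrite ≢⇒≡ᵇ-false x≢j | ≢⇒≡ᵇ-false x≢1+j =
  openAfter-avoiding o av

unpaired-replicate-raised : ∀ j o p b → unpaired j o p (replicate b (suc j)) ≡ []
unpaired-replicate-raised j o p zero = refl
unpaired-replicate-raised j o p (suc b) rewrite ≢⇒≡ᵇ-false (1+n≢n {j}) | ≡ᵇ-refl j =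
  unpaired-replicate-raised j (suc o) (suc p) b

openAfter-replicate-raised : ∀ j o b → openAfter j o (replicate b (suc j)) ≡ b + o
openAfter-replicate-raised j o zero = refl
openAfter-replicate-raised j o (suc b) rewrite ≢⇒≡ᵇ-false (1+n≢n {j}) | ≡ᵇ-refl j =
  trans (openAfter-replicate-raised j (suc o) b) (+-suc b o)

unpaired-replicate : ∀ j o p a → a ≤ o → unpaired j o p (replicate a j) ≡ []
unpaired-replicate j o       p zero    a≤o       = refl
unpaired-replicate j (suc o) p (suc a) (s≤s a≤o) rewrite ≡ᵇ-refl j = unpaired-replicate j o (suc p) a a≤o

openAfter-replicate : ∀ j o a → openAfter j o (replicate a j) ≡ o ∸ a
openAfter-replicate j o zero    = refl
openAfter-replicate j zero    (suc a) rewrite ≡ᵇ-refl j = trans (openAfter-replicate j 0 a) (0∸n≡0 a)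
openAfter-replicate j (suc o) (suc a) rewrite ≡ᵇ-refl j = openAfter-replicate j o a

Below Above : ℕ → List ℕ → Set
Below j = All (_< j)
Above j = All (suc j <_)

below⇒avoids : ∀ {j w} → Below j w → Avoids j w
below⇒avoids = All.map (λ x<j → <⇒≢ x<j , <⇒≢ (m<n⇒m<1+n x<j))

above⇒avoids : ∀ {j w} → Above j w → Avoids j w
above⇒avoids = All.map (λ 1+j<x → ≢-sym (<⇒≢ (<-trans (n<1+n _) 1+j<x)) , ≢-sym (<⇒≢ 1+j<x))

below-mono : ∀ {j j′ w} → j ≤ j′ → Below j w → Below j′ w
below-mono j≤j′ = All.map (λ x<j → <-≤-trans x<j j≤j′)

above-mono : ∀ {j j′ w} → j ≤ j′ → Above j′ w → Above j w
above-mono j≤j′ = All.map (≤-<-trans (s≤s j≤j′))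

openAfter-prefix : ∀ {j pre} o a → Below j pre → openAfter j o (pre ++ replicate a j) ≡ o ∸ a
openAfter-prefix {j} {pre} o a lo = begin
  openAfter j o (pre ++ replicate a j)                   ≡⟨ openAfter-++ j o pre _ ⟩
  openAfter j (openAfter j o pre) (replicate a j)        ≡⟨ cong (λ o′ → openAfter j o′ (replicate a j)) (openAfter-avoiding o (below⇒avoids lo)) ⟩
  openAfter j o (replicate a j)                          ≡⟨ openAfter-replicate j o a ⟩
  o ∸ a                                                  ∎
  where open ≡-Reasoning

unpaired-prefix : ∀ {j pre} o p a → Below j pre → a ≤ o → unpaired j o p (pre ++ replicate a j) ≡ []
unpaired-prefix {j} {pre} o p a lo a≤o = begin
  unpaired j o p (pre ++ replicate a j)                                              ≡⟨ unpaired-++ j o p pre _ ⟩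
  unpaired j o p pre ++ unpaired j (openAfter j o pre) (p + length pre) (replicate a j)
    ≡⟨ cong₂ _++_ (unpaired-avoiding o p (below⇒avoids lo))
                  (cong (λ o′ → unpaired j o′ (p + length pre) (replicate a j)) (openAfter-avoiding o (below⇒avoids lo))) ⟩
  unpaired j o (p + length pre) (replicate a j)                                      ≡⟨ unpaired-replicate j o _ a a≤o ⟩
  []                                                                                 ∎
  where open ≡-Reasoning

openAfter-suffix : ∀ {j post} o b → Above j post → openAfter j o (replicate b (suc j) ++ post) ≡ b + o
openAfter-suffix {j} o b hi = trans (openAfter-++ j o (replicate b (suc j)) _)
  (trans (openAfter-avoiding _ (above⇒avoids hi)) (openAfter-replicate-raised j o b))

unpaired-suffix : ∀ {j post} o p b → Above j post → unpaired j o p (replicate b (suc j) ++ post) ≡ []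
unpaired-suffix {j} o p b hi = trans (unpaired-++ j o p (replicate b (suc j)) _)
  (cong₂ _++_ (unpaired-replicate-raised j o p b) (unpaired-avoiding _ _ (above⇒avoids hi)))

last-∷ʳ : ∀ (xs : List ℕ) x → last (xs ++ x ∷ []) ≡ just x
last-∷ʳ []           x = refl
last-∷ʳ (y ∷ [])     x = refl
last-∷ʳ (y ∷ z ∷ xs) x = last-∷ʳ (z ∷ xs) x

setAt-length : ∀ xs x ys v → setAt (xs ++ x ∷ ys) (length xs) v ≡ xs ++ v ∷ ys
setAt-length []       x ys v = refl
setAt-length (y ∷ xs) x ys v = cong (y ∷_) (setAt-length xs x ys v)

fWord-at : ∀ j w p → last (unpaired j 0 0 w) ≡ just p → fWord j w ≡ just (setAt w p (suc j))
fWord-at j w p eq rewrite eq = refl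

fWord-raise : ∀ j X Y → openAfter j 0 X ≡ 0 → (∀ p → unpaired j 0 p Y ≡ []) →
  fWord j (X ++ j ∷ Y) ≡ just (X ++ suc j ∷ Y)
fWord-raise j X Y closed Y-paired =
  trans (fWord-at j _ _ (trans (cong last unpaired-X-j-Y) (last-∷ʳ (unpaired j 0 0 X) (length X))))
        (cong just (setAt-length X j Y (suc j)))
  where
  unpaired-X-j-Y : unpaired j 0 0 (X ++ j ∷ Y) ≡ unpaired j 0 0 X ++ length X ∷ []
  unpaired-X-j-Y rewrite unpaired-++ j 0 0 X (j ∷ Y) | closed | ≡ᵇ-refl j | Y-paired (suc (length X)) = refl

take-length-++ : ∀ (xs ys : List ℕ) → take (length xs) (xs ++ ys) ≡ xs
take-length-++ []       ys = refl
take-length-++ (x ∷ xs) ys = cong (x ∷_) (take-length-++ xs ys)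

drop-length-++ : ∀ (xs ys : List ℕ) → drop (length xs) (xs ++ ys) ≡ ys
drop-length-++ []       ys = refl
drop-length-++ (x ∷ xs) ys = drop-length-++ xs ys

chunk-concat : ∀ (R : Tableau) → chunk (map length R) (concat R) ≡ R
chunk-concat []      = refl
chunk-concat (r ∷ R) rewrite take-length-++ r (concat R) | drop-length-++ r (concat R) = cong (r ∷_) (chunk-concat R)

fT-at : ∀ j T w → fWord j (readWord T) ≡ just w → fT j T ≡ just (reverse (chunk (map length (reverse T)) w))
fT-at j T w eq rewrite eq = refl

fT-via-fWord : ∀ j {T T′} → map length T′ ≡ map length T → fWord j (readWord T) ≡ just (readWord T′) → fT j T ≡ just T′
fT-via-fWord j {T} {T′} shape eq = trans (fT-at j T _ eq) (cong just (begin
  reverse (chunk (map length (reverse T)) (concat (reverse T′)))   ≡⟨ cong (λ ls → reverse (chunk ls (concat (reverse T′)))) same-lengths ⟩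
  reverse (chunk (map length (reverse T′)) (concat (reverse T′)))  ≡⟨ cong reverse (chunk-concat (reverse T′)) ⟩
  reverse (reverse T′)                                             ≡⟨ reverse-involutive T′ ⟩
  T′                                                               ∎))
  where
  open ≡-Reasoning
  same-lengths : map length (reverse T) ≡ map length (reverse T′)
  same-lengths = trans (reverse-map length T) (trans (cong reverse (sym shape)) (sym (reverse-map length T′)))

fT-raise : ∀ j {T T′} X Y → readWord T ≡ X ++ j ∷ Y → readWord T′ ≡ X ++ suc j ∷ Y → map length T′ ≡ map length T →
  openAfter j 0 X ≡ 0 → (∀ p → unpaired j 0 p Y ≡ []) → fT j T ≡ just T′
fT-raise j X Y word word′ shape closed Y-paired =
  fT-via-fWord j shape (trans (cong (fWord j) word) (trans (fWord-raise j X Y closed Y-paired) (cong just (sym word′))))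

readWord-one : ∀ r → readWord (r ∷ []) ≡ r
readWord-one = ++-identityʳ

readWord-two : ∀ r₁ r₂ → readWord (r₁ ∷ r₂ ∷ []) ≡ r₂ ++ r₁
readWord-two r₁ r₂ = cong (r₂ ++_) (++-identityʳ r₁)

row : ℕ → List ℕ → ℕ → ℕ → List ℕ → List ℕ
row j pre a b post = pre ++ replicate a j ++ replicate b (suc j) ++ post

row-split : ∀ j pre a b post → row j pre a b post ≡ (pre ++ replicate a j) ++ replicate b (suc j) ++ post
row-split j pre a b post = sym (++-assoc pre _ _)

replicate-suc-++ : ∀ a (x : ℕ) ys → replicate (suc a) x ++ ys ≡ replicate a x ++ x ∷ ys
replicate-suc-++ zero    x ys = refl
replicate-suc-++ (suc a) x ys = cong (x ∷_) (replicate-suc-++ a x ys)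

row-lowered : ∀ j pre a b post → row j pre (suc a) b post ≡ (pre ++ replicate a j) ++ j ∷ replicate b (suc j) ++ post
row-lowered j pre a b post =
  trans (cong (pre ++_) (replicate-suc-++ a j _)) (sym (++-assoc pre (replicate a j) _))

row-raised : ∀ j pre a b post → row j pre a (suc b) post ≡ (pre ++ replicate a j) ++ suc j ∷ replicate b (suc j) ++ post
row-raised j pre a b post = sym (++-assoc pre (replicate a j) _)

length-row-raise : ∀ j pre a b post → length (row j pre a (suc b) post) ≡ length (row j pre (suc a) b post)
length-row-raise j pre a b post = begin
  length (row j pre a (suc b) post)                ≡⟨ cong length (row-raised j pre a b post) ⟩
  length ((pre ++ replicate a j) ++ suc j ∷ Y)     ≡⟨ length-++ (pre ++ replicate a j) ⟩
  length (pre ++ replicate a j) + length (j ∷ Y)   ≡⟨ sym (length-++ (pre ++ replicate a j)) ⟩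
  length ((pre ++ replicate a j) ++ j ∷ Y)         ≡⟨ cong length (sym (row-lowered j pre a b post)) ⟩
  length (row j pre (suc a) b post)                ∎
  where
  open ≡-Reasoning
  Y = replicate b (suc j) ++ post

openAfter-row : ∀ {j pre post} o a b → Below j pre → Above j post →
  openAfter j o (row j pre a b post) ≡ b + (o ∸ a)
openAfter-row {j} {pre} {post} o a b lo hi = begin
  openAfter j o (row j pre a b post)                                                   ≡⟨ cong (openAfter j o) (row-split j pre a b post) ⟩
  openAfter j o ((pre ++ replicate a j) ++ replicate b (suc j) ++ post)                ≡⟨ openAfter-++ j o (pre ++ replicate a j) _ ⟩
  openAfter j (openAfter j o (pre ++ replicate a j)) (replicate b (suc j) ++ post)
    ≡⟨ cong (λ o′ → openAfter j o′ (replicate b (suc j) ++ post)) (openAfter-prefix o a lo) ⟩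
  openAfter j (o ∸ a) (replicate b (suc j) ++ post)                                    ≡⟨ openAfter-suffix (o ∸ a) b hi ⟩
  b + (o ∸ a)                                                                          ∎
  where open ≡-Reasoning

unpaired-row : ∀ {j pre post} o p a b → Below j pre → Above j post → a ≤ o →
  unpaired j o p (row j pre a b post) ≡ []
unpaired-row {j} {pre} {post} o p a b lo hi a≤o = begin
  unpaired j o p (row j pre a b post)                                              ≡⟨ cong (unpaired j o p) (row-split j pre a b post) ⟩
  unpaired j o p ((pre ++ replicate a j) ++ replicate b (suc j) ++ post)           ≡⟨ unpaired-++ j o p (pre ++ replicate a j) _ ⟩
  unpaired j o p (pre ++ replicate a j) ++ unpaired j _ _ (replicate b (suc j) ++ post)
    ≡⟨ cong₂ _++_ (unpaired-prefix o p a lo a≤o) (unpaired-suffix _ _ b hi) ⟩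
  []                                                                               ∎
  where open ≡-Reasoning

fT-row : ∀ {j pre post} a b → Below j pre → Above j post →
  fT j (row j pre (suc a) b post ∷ []) ≡ just (row j pre a (suc b) post ∷ [])
fT-row {j} {pre} {post} a b lo hi =
  fT-raise j (pre ++ replicate a j) (replicate b (suc j) ++ post)
    (trans (readWord-one (row j pre (suc a) b post)) (row-lowered j pre a b post))
    (trans (readWord-one (row j pre a (suc b) post)) (row-raised j pre a b post))
    (cong (_∷ []) (length-row-raise j pre a b post))
    (trans (openAfter-prefix 0 a lo) (0∸n≡0 a))
    (λ p → unpaired-suffix 0 p b hi)

fT-top : ∀ {j pre₁ post₁ pre₂ post₂} a₁ b₁ a₂ b₂ →
  Below j pre₁ → Above j post₁ → Below j pre₂ → Above j post₂ → b₂ ≤ a₁ →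
  fT j (row j pre₁ (suc a₁) b₁ post₁ ∷ row j pre₂ a₂ b₂ post₂ ∷ [])
    ≡ just (row j pre₁ a₁ (suc b₁) post₁ ∷ row j pre₂ a₂ b₂ post₂ ∷ [])
fT-top {j} {pre₁} {post₁} {pre₂} {post₂} a₁ b₁ a₂ b₂ lo₁ hi₁ lo₂ hi₂ b₂≤a₁ =
  fT-raise j (r₂ ++ pre₁ ++ replicate a₁ j) (replicate b₁ (suc j) ++ post₁)
    (trans (readWord-two (row j pre₁ (suc a₁) b₁ post₁) r₂)
           (trans (cong (r₂ ++_) (row-lowered j pre₁ a₁ b₁ post₁)) (sym (++-assoc r₂ _ _))))
    (trans (readWord-two (row j pre₁ a₁ (suc b₁) post₁) r₂)
           (trans (cong (r₂ ++_) (row-raised j pre₁ a₁ b₁ post₁)) (sym (++-assoc r₂ _ _))))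
    (cong (λ l → l ∷ length r₂ ∷ []) (length-row-raise j pre₁ a₁ b₁ post₁))
    closed
    (λ p → unpaired-suffix 0 p b₁ hi₁)
  where
  open ≡-Reasoning
  r₂ = row j pre₂ a₂ b₂ post₂
  closed : openAfter j 0 (r₂ ++ pre₁ ++ replicate a₁ j) ≡ 0
  closed = begin
    openAfter j 0 (r₂ ++ pre₁ ++ replicate a₁ j)                  ≡⟨ openAfter-++ j 0 r₂ _ ⟩
    openAfter j (openAfter j 0 r₂) (pre₁ ++ replicate a₁ j)        ≡⟨ openAfter-prefix _ a₁ lo₁ ⟩
    openAfter j 0 r₂ ∸ a₁                                          ≡⟨ cong (_∸ a₁) (openAfter-row 0 a₂ b₂ lo₂ hi₂) ⟩
    b₂ + (0 ∸ a₂) ∸ a₁                                             ≡⟨ cong (λ z → b₂ + z ∸ a₁) (0∸n≡0 a₂) ⟩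
    b₂ + 0 ∸ a₁                                                    ≡⟨ m≤n⇒m∸n≡0 (≤-trans (≤-reflexive (+-identityʳ b₂)) b₂≤a₁) ⟩
    0                                                              ∎

fT-bottom : ∀ {j pre₁ post₁ pre₂ post₂} a₁ b₁ a₂ b₂ →
  Below j pre₁ → Above j post₁ → Below j pre₂ → Above j post₂ → a₁ ≤ b₂ →
  fT j (row j pre₁ a₁ b₁ post₁ ∷ row j pre₂ (suc a₂) b₂ post₂ ∷ [])
    ≡ just (row j pre₁ a₁ b₁ post₁ ∷ row j pre₂ a₂ (suc b₂) post₂ ∷ [])
fT-bottom {j} {pre₁} {post₁} {pre₂} {post₂} a₁ b₁ a₂ b₂ lo₁ hi₁ lo₂ hi₂ a₁≤b₂ =
  fT-raise j (pre₂ ++ replicate a₂ j) (Y₂ ++ r₁)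
    (trans (readWord-two r₁ (row j pre₂ (suc a₂) b₂ post₂))
           (trans (cong (_++ r₁) (row-lowered j pre₂ a₂ b₂ post₂)) (++-assoc _ (j ∷ Y₂) r₁)))
    (trans (readWord-two r₁ (row j pre₂ a₂ (suc b₂) post₂))
           (trans (cong (_++ r₁) (row-raised j pre₂ a₂ b₂ post₂)) (++-assoc _ (suc j ∷ Y₂) r₁)))
    (cong (λ l → length r₁ ∷ l ∷ []) (length-row-raise j pre₂ a₂ b₂ post₂))
    (trans (openAfter-prefix 0 a₂ lo₂) (0∸n≡0 a₂))
    paired
  where
  open ≡-Reasoning
  r₁ = row j pre₁ a₁ b₁ post₁
  Y₂ = replicate b₂ (suc j) ++ post₂
  paired : ∀ p → unpaired j 0 p (Y₂ ++ r₁) ≡ []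
  paired p = begin
    unpaired j 0 p (Y₂ ++ r₁)                                           ≡⟨ unpaired-++ j 0 p Y₂ r₁ ⟩
    unpaired j 0 p Y₂ ++ unpaired j (openAfter j 0 Y₂) (p + length Y₂) r₁ ≡⟨ cong₂ _++_ (unpaired-suffix 0 p b₂ hi₂)
                                                                            (cong (λ o → unpaired j o (p + length Y₂) r₁) (openAfter-suffix 0 b₂ hi₂)) ⟩
    unpaired j (b₂ + 0) (p + length Y₂) r₁                                ≡⟨ unpaired-row (b₂ + 0) _ a₁ b₁ lo₁ hi₁ (≤-trans a₁≤b₂ (m≤m+n b₂ 0)) ⟩
    []                                                                  ∎

-- Column strictness

All-replicate : ∀ {P : ℕ → Set} {x} a → P x → All P (replicate a x)
All-replicate zero    px = []
All-replicate (suc a) px = px ∷ All-replicate a px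

atMost : ℕ → List ℕ → ℕ
atMost w xs = length (filter (_≤? w) xs)

atMost-++ : ∀ w xs ys → atMost w (xs ++ ys) ≡ atMost w xs + atMost w ys
atMost-++ w xs ys = trans (cong length (filter-++ (_≤? w) xs ys)) (length-++ (filter (_≤? w) xs))

atMost-all : ∀ {w xs} → All (_≤ w) xs → atMost w xs ≡ length xs
atMost-all {w} all = cong length (filter-all (_≤? w) all)

atMost-none : ∀ {w xs} → All (w <_) xs → atMost w xs ≡ 0
atMost-none {w} none = cong length (filter-none (_≤? w) (All.map <⇒≱ none))

atMost-accept : ∀ {w x} ys → x ≤ w → atMost w (x ∷ ys) ≡ suc (atMost w ys)
atMost-accept {w} ys x≤w = cong length (filter-accept (_≤? w) x≤w)

atMost-reject : ∀ {w x} ys → ¬ x ≤ w → atMost w (x ∷ ys) ≡ atMost w ys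
atMost-reject {w} ys x≰w = cong length (filter-reject (_≤? w) x≰w)

atMost-∷-≤ : ∀ w x ys → atMost w (x ∷ ys) ≤ suc (atMost w ys)
atMost-∷-≤ w x ys with x ≤? w
... | yes x≤w = ≤-reflexive (atMost-accept ys x≤w)
... | no x≰w  = ≤-trans (≤-reflexive (atMost-reject ys x≰w)) (n≤1+n _)

atMost-raise : ∀ w X x Y → atMost w (X ++ suc x ∷ Y) ≤ atMost w (X ++ x ∷ Y)
atMost-raise w X x Y rewrite atMost-++ w X (suc x ∷ Y) | atMost-++ w X (x ∷ Y) = +-monoʳ-≤ (atMost w X) raise
  where
  raise : atMost w (suc x ∷ Y) ≤ atMost w (x ∷ Y)
  raise with x ≤? w
  ... | yes x≤w = ≤-trans (atMost-∷-≤ w (suc x) Y) (≤-reflexive (sym (atMost-accept Y x≤w)))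
  ... | no x≰w  = ≤-reflexive (trans (atMost-reject Y (x≰w ∘ <⇒≤)) (sym (atMost-reject Y x≰w)))

atMost-raise-≢ : ∀ w X x Y → w ≢ x → atMost w (X ++ suc x ∷ Y) ≡ atMost w (X ++ x ∷ Y)
atMost-raise-≢ w X x Y w≢x rewrite atMost-++ w X (suc x ∷ Y) | atMost-++ w X (x ∷ Y) = cong (atMost w X +_) raise
  where
  raise : atMost w (suc x ∷ Y) ≡ atMost w (x ∷ Y)
  raise with x ≤? w
  ... | yes x≤w = trans (atMost-accept Y (≤∧≢⇒< x≤w (≢-sym w≢x))) (sym (atMost-accept Y x≤w))
  ... | no x≰w  = trans (atMost-reject Y (x≰w ∘ <⇒≤)) (sym (atMost-reject Y x≰w))

atMost-row : ∀ w j pre a b post →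
  atMost w (row j pre a b post) ≡ atMost w pre + (atMost w (replicate a j) + (atMost w (replicate b (suc j)) + atMost w post))
atMost-row w j pre a b post = begin
  atMost w (row j pre a b post)    ≡⟨ atMost-++ w pre _ ⟩
  atMost w pre + atMost w (replicate a j ++ replicate b (suc j) ++ post)
                                   ≡⟨ cong (atMost w pre +_) (atMost-++ w (replicate a j) _) ⟩
  atMost w pre + (atMost w (replicate a j) + atMost w (replicate b (suc j) ++ post))
                                   ≡⟨ cong (λ z → atMost w pre + (atMost w (replicate a j) + z)) (atMost-++ w (replicate b (suc j)) post) ⟩
  _                                ∎
  where open ≡-Reasoning

module _ {j pre post} (a b : ℕ) (lo : Below (suc j) pre) (hi : Above (suc j) post) where

  atMost-row-below : atMost j (row (suc j) pre a b post) ≡ length pre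
  atMost-row-below rewrite atMost-row j (suc j) pre a b post
    | atMost-all (All.map (λ x<1+j → ≤-pred x<1+j) lo)
    | atMost-none {j} (All-replicate {j <_} a (n<1+n j))
    | atMost-none {j} (All-replicate {j <_} b (m<n⇒m<1+n (n<1+n j)))
    | atMost-none {j} (All.map (<-trans (m<n⇒m<1+n (n<1+n j))) hi)
    = +-identityʳ (length pre)

  atMost-row-at : atMost (suc j) (row (suc j) pre a b post) ≡ length pre + a
  atMost-row-at rewrite atMost-row (suc j) (suc j) pre a b post
    | atMost-all (All.map <⇒≤ lo)
    | atMost-all {suc j} (All-replicate {_≤ suc j} a ≤-refl)
    | length-replicate a {suc j}
    | atMost-none {suc j} (All-replicate {suc j <_} b ≤-refl)
    | atMost-none {suc j} (All.map (λ 2+j<x → <-trans (n<1+n (suc j)) 2+j<x) hi)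
    = cong (length pre +_) (+-identityʳ a)

  atMost-row-above : atMost (suc (suc j)) (row (suc j) pre a b post) ≡ length pre + (a + b)
  atMost-row-above rewrite atMost-row (suc (suc j)) (suc j) pre a b post
    | atMost-all (All.map (λ x<1+j → ≤-trans (<⇒≤ x<1+j) (n≤1+n (suc j))) lo)
    | atMost-all {suc (suc j)} (All-replicate {_≤ suc (suc j)} a (n≤1+n (suc j)))
    | length-replicate a {suc j}
    | atMost-all {suc (suc j)} (All-replicate {_≤ suc (suc j)} b ≤-refl)
    | length-replicate b {suc (suc j)}
    | atMost-none hi
    = cong (λ z → length pre + (a + z)) (+-identityʳ b)

-- For weakly increasing rows r₁ above r₂ of equal length, this is strict increase down the columns.
ColumnStrict : List ℕ → List ℕ → Set
ColumnStrict r₁ r₂ = ∀ v → atMost (suc v) r₂ ≤ atMost v r₁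

columnStrict-raise-bottom : ∀ {r₁} j pre a b post →
  ColumnStrict r₁ (row j pre (suc a) b post) → ColumnStrict r₁ (row j pre a (suc b) post)
columnStrict-raise-bottom {r₁} j pre a b post cs v = begin
  atMost (suc v) (row j pre a (suc b) post)  ≡⟨ cong (atMost (suc v)) (row-raised j pre a b post) ⟩
  atMost (suc v) (X ++ suc j ∷ Y)            ≤⟨ atMost-raise (suc v) X j Y ⟩
  atMost (suc v) (X ++ j ∷ Y)                ≡⟨ cong (atMost (suc v)) (sym (row-lowered j pre a b post)) ⟩
  atMost (suc v) (row j pre (suc a) b post)  ≤⟨ cs v ⟩
  atMost v r₁                                ∎
  where
  open ≤-Reasoning
  X = pre ++ replicate a j
  Y = replicate b (suc j) ++ post

columnStrict-raise-top : ∀ {j pre₁ post₁ pre₂ post₂} a₁ b₁ a₂ b₂ →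
  Below (suc j) pre₁ → Above (suc j) post₁ → Below (suc j) pre₂ → Above (suc j) post₂ → b₂ ≤ a₁ →
  ColumnStrict (row (suc j) pre₁ (suc a₁) b₁ post₁) (row (suc j) pre₂ a₂ b₂ post₂) →
  ColumnStrict (row (suc j) pre₁ a₁ (suc b₁) post₁) (row (suc j) pre₂ a₂ b₂ post₂)
columnStrict-raise-top {j} {pre₁} {post₁} {pre₂} a₁ b₁ a₂ b₂ lo₁ hi₁ lo₂ hi₂ b₂≤a₁ cs v with v ≟ suc j
... | no v≢1+j = subst (atMost (suc v) (row (suc j) pre₂ a₂ b₂ _) ≤_) (sym unchanged) (cs v)
  where
  open ≡-Reasoning
  unchanged : atMost v (row (suc j) pre₁ a₁ (suc b₁) post₁) ≡ atMost v (row (suc j) pre₁ (suc a₁) b₁ post₁)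
  unchanged = begin
    atMost v (row (suc j) pre₁ a₁ (suc b₁) post₁)     ≡⟨ cong (atMost v) (row-raised (suc j) pre₁ a₁ b₁ post₁) ⟩
    atMost v (X ++ suc (suc j) ∷ Y)                    ≡⟨ atMost-raise-≢ v X (suc j) Y v≢1+j ⟩
    atMost v (X ++ suc j ∷ Y)                          ≡⟨ cong (atMost v) (sym (row-lowered (suc j) pre₁ a₁ b₁ post₁)) ⟩
    atMost v (row (suc j) pre₁ (suc a₁) b₁ post₁)     ∎
    where
    X = pre₁ ++ replicate a₁ (suc j)
    Y = replicate b₁ (suc (suc j)) ++ post₁
... | yes refl = begin
  atMost (suc (suc j)) (row (suc j) pre₂ a₂ b₂ _)   ≡⟨ atMost-row-above a₂ b₂ lo₂ hi₂ ⟩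
  length pre₂ + (a₂ + b₂)                          ≡⟨ sym (+-assoc (length pre₂) a₂ b₂) ⟩
  length pre₂ + a₂ + b₂                            ≤⟨ +-mono-≤ below-row₁ b₂≤a₁ ⟩
  length pre₁ + a₁                                 ≡⟨ sym (atMost-row-at a₁ (suc b₁) lo₁ hi₁) ⟩
  atMost (suc j) (row (suc j) pre₁ a₁ (suc b₁) _)  ∎
  where
  open ≤-Reasoning
  below-row₁ : length pre₂ + a₂ ≤ length pre₁
  below-row₁ = subst₂ _≤_ (atMost-row-at a₂ b₂ lo₂ hi₂) (atMost-row-below (suc a₁) b₁ lo₁ hi₁) (cs j)

PairStrict : Tableau → Set
PairStrict (r₁ ∷ r₂ ∷ []) = ColumnStrict r₁ r₂
PairStrict _              = ⊥

applyUpTo-cong : ∀ {f g : ℕ → ℕ} r → (∀ x → f x ≡ g x) → applyUpTo f r ≡ applyUpTo g r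
applyUpTo-cong zero    f≗g = refl
applyUpTo-cong (suc r) f≗g = cong₂ _∷_ (f≗g 0) (applyUpTo-cong r (f≗g ∘ suc))

fromTo-cons : ∀ {lo hi} → lo ≤ hi → fromTo lo hi ≡ lo ∷ fromTo (suc lo) hi
fromTo-cons {lo} {hi} lo≤hi rewrite +-∸-assoc 1 lo≤hi =
  cong₂ _∷_ (+-identityʳ lo) (applyUpTo-cong (hi ∸ lo) (+-suc lo))

fromTo-empty : ∀ {lo hi} → hi < lo → fromTo lo hi ≡ []
fromTo-empty hi<lo rewrite m≤n⇒m∸n≡0 hi<lo = refl

fromTo-snoc : ∀ {lo hi} → lo ≤ suc hi → fromTo lo (suc hi) ≡ fromTo lo hi ∷ʳ suc hi
fromTo-snoc {lo} {hi} lo≤1+hi rewrite +-∸-assoc 1 lo≤1+hi =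
  trans (sym (applyUpTo-∷ʳ (lo +_) (suc hi ∸ lo))) (cong (fromTo lo hi ∷ʳ_) (m+[n∸m]≡n lo≤1+hi))

sumN-cons : ∀ {lo hi} f → lo ≤ hi → sumN lo hi f ≡ f lo + sumN (suc lo) hi f
sumN-cons f lo≤hi rewrite fromTo-cons lo≤hi = refl

sumN-empty : ∀ {lo hi} f → hi < lo → sumN lo hi f ≡ 0
sumN-empty f hi<lo rewrite fromTo-empty hi<lo = refl

sumN-single : ∀ b f → sumN b b f ≡ f b
sumN-single b f = trans (sumN-cons f ≤-refl) (trans (cong (f b +_) (sumN-empty {suc b} {b} f ≤-refl)) (+-identityʳ (f b)))

sumN-snoc : ∀ {lo hi} f → lo ≤ suc hi → sumN lo (suc hi) f ≡ sumN lo hi f + f (suc hi)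
sumN-snoc {lo} {hi} f lo≤1+hi rewrite fromTo-snoc lo≤1+hi | map-++ f (fromTo lo hi) (suc hi ∷ [])
  | sum-++ (map f (fromTo lo hi)) (f (suc hi) ∷ []) = cong (sumN lo hi f +_) (+-identityʳ (f (suc hi)))

sumN-zeros : ∀ lo hi → sumN lo hi (λ _ → 0) ≡ 0
sumN-zeros lo hi = zeros (fromTo lo hi)
  where
  zeros : ∀ (js : List ℕ) → sum (map (λ _ → 0) js) ≡ 0
  zeros []       = refl
  zeros (_ ∷ js) = zeros js

column : ∀ {p b e} → b ≤‴ e → Path (p , b) (p , e)
column ≤‴-refl         = stop
column (≤‴-step b<e)   = down ∷ column b<e

column-then-right : ∀ {p b e z} → b ≤‴ e → Path (suc p , e) z → Path (p , b) z
column-then-right ≤‴-refl       γ = right ∷ γ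
column-then-right (≤‴-step b<e) γ = down ∷ column-then-right b<e γ

pathSum-column : ∀ A {p b e} (b≤e : b ≤‴ e) → pathSum A (column {p} b≤e) ≡ sumN b e (A p)
pathSum-column A {p} {b} ≤‴-refl       = sym (sumN-single b (A p))
pathSum-column A {p} {b} (≤‴-step b<e) =
  trans (cong (A p b +_) (pathSum-column A b<e)) (sym (sumN-cons (A p) (≤‴⇒≤ (≤‴-step b<e))))

pathSum-column-then-right : ∀ A {p b e z} (b≤e : b ≤‴ e) (γ : Path (suc p , e) z) →
  pathSum A (column-then-right b≤e γ) ≡ sumN b e (A p) + pathSum A γ
pathSum-column-then-right A {p} {b} ≤‴-refl       γ = cong (_+ pathSum A γ) (sym (sumN-single b (A p)))
pathSum-column-then-right A {p} {b} (≤‴-step b<e) γ = begin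
  A p b + pathSum A (column-then-right b<e γ)      ≡⟨ cong (A p b +_) (pathSum-column-then-right A b<e γ) ⟩
  A p b + (sumN (suc b) _ (A p) + pathSum A γ)     ≡⟨ sym (+-assoc (A p b) _ _) ⟩
  A p b + sumN (suc b) _ (A p) + pathSum A γ       ≡⟨ cong (_+ pathSum A γ) (sym (sumN-cons (A p) (≤‴⇒≤ (≤‴-step b<e)))) ⟩
  sumN b _ (A p) + pathSum A γ                     ∎
  where open ≡-Reasoning

record Transforms (P : Tableau → Set) (g : Tableau → Maybe Tableau) (T T′ : Tableau) : Set where
  field run : P T → g T ≡ just T′ × P T′

open Transforms

transforms-just : ∀ {P T} → Transforms P just T T
transforms-just .run p = refl , p

transforms-⊤ : ∀ {g T T′} → g T ≡ just T′ → Transforms (λ _ → ⊤) g T T′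
transforms-⊤ computes .run _ = computes , tt

transforms-≡ : ∀ {P g T T₁ T′} → T₁ ≡ T′ → Transforms P g T T₁ → Transforms P g T T′
transforms-≡ refl t = t

transforms-cong : ∀ {P g T₁ T₂ T₁′ T₂′} → T₁ ≡ T₂ → T₁′ ≡ T₂′ →
  Transforms P g T₁ T₁′ → Transforms P g T₂ T₂′
transforms-cong refl refl t = t

transforms-∷ : ∀ {P g gs T T₁ T₂} →
  Transforms P g T T₁ → Transforms P (applyAll gs) T₁ T₂ → Transforms P (applyAll (g ∷ gs)) T T₂
transforms-∷ {gs = gs} g-step gs-steps .run p with run g-step p
... | computes₁ , p₁ with run gs-steps p₁
... | computes₂ , p₂ = trans (cong (_>>= applyAll gs) computes₁) computes₂ , p₂

applyAll-++ : ∀ gs hs T → applyAll (gs ++ hs) T ≡ (applyAll gs T >>= applyAll hs)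
applyAll-++ []       hs T = refl
applyAll-++ (g ∷ gs) hs T with g T
... | nothing = refl
... | just T₁  = applyAll-++ gs hs T₁

transforms-++ : ∀ {P} gs hs {T T₁ T₂} →
  Transforms P (applyAll gs) T T₁ → Transforms P (applyAll hs) T₁ T₂ → Transforms P (applyAll (gs ++ hs)) T T₂
transforms-++ gs hs gs-steps hs-steps .run p with run gs-steps p
... | computes₁ , p₁ with run hs-steps p₁
... | computes₂ , p₂ = trans (applyAll-++ gs hs _) (trans (cong (_>>= applyAll hs) computes₁) computes₂) , p₂

fPow-row : ∀ {j pre post a} a′ b x → Below j pre → Above j post → a ≡ a′ + x →
  fPow j x (row j pre a b post ∷ []) ≡ just (row j pre a′ (b + x) post ∷ [])
fPow-row {j} {pre} {post} a′ b zero lo hi a≡ =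
  cong₂ (λ a b → just (row j pre a b post ∷ [])) (trans a≡ (+-identityʳ a′)) (sym (+-identityʳ b))
fPow-row {j} {pre} {post} {a} a′ b (suc x) lo hi a≡ = begin
  (fPow j x (row j pre a b post ∷ []) >>= fT j)     ≡⟨ cong (_>>= fT j) (fPow-row (suc a′) b x lo hi (trans a≡ (+-suc a′ x))) ⟩
  fT j (row j pre (suc a′) (b + x) post ∷ [])        ≡⟨ fT-row a′ (b + x) lo hi ⟩
  just (row j pre a′ (suc (b + x)) post ∷ [])        ≡⟨ cong (λ b′ → just (row j pre a′ b′ post ∷ [])) (sym (+-suc b x)) ⟩
  just (row j pre a′ (b + suc x) post ∷ [])          ∎
  where open ≡-Reasoning

module _ {j pre₁ post₁ pre₂ post₂}
         (lo₁ : Below (suc j) pre₁) (hi₁ : Above (suc j) post₁) (lo₂ : Below (suc j) pre₂) (hi₂ : Above (suc j) post₂) where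

  private
    row₁ row₂ : ℕ → ℕ → List ℕ
    row₁ a b = row (suc j) pre₁ a b post₁
    row₂ a b = row (suc j) pre₂ a b post₂

  fPow-top : ∀ {a₁} a₁′ b₁ a₂ b₂ x → a₁ ≡ a₁′ + x → b₂ ≤ a₁′ →
    Transforms PairStrict (fPow (suc j) x) (row₁ a₁ b₁ ∷ row₂ a₂ b₂ ∷ []) (row₁ a₁′ (b₁ + x) ∷ row₂ a₂ b₂ ∷ [])
  fPow-top a₁′ b₁ a₂ b₂ zero a₁≡ _ =
    transforms-≡ (cong₂ (λ a b → row₁ a b ∷ row₂ a₂ b₂ ∷ []) (trans a₁≡ (+-identityʳ a₁′)) (sym (+-identityʳ b₁)))
      transforms-just
  fPow-top a₁′ b₁ a₂ b₂ (suc x) a₁≡ b₂≤a₁′ .run cs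
    with run (fPow-top (suc a₁′) b₁ a₂ b₂ x (trans a₁≡ (+-suc a₁′ x)) (m≤n⇒m≤1+n b₂≤a₁′)) cs
  ... | computes , cs′ =
    trans (cong (_>>= fT (suc j)) computes)
      (trans (fT-top a₁′ (b₁ + x) a₂ b₂ lo₁ hi₁ lo₂ hi₂ b₂≤a₁′)
             (cong (λ b → just (row₁ a₁′ b ∷ row₂ a₂ b₂ ∷ [])) b₁+x+1≡)) ,
    subst (λ b → ColumnStrict (row₁ a₁′ b) (row₂ a₂ b₂)) b₁+x+1≡
      (columnStrict-raise-top a₁′ (b₁ + x) a₂ b₂ lo₁ hi₁ lo₂ hi₂ b₂≤a₁′ cs′)
    where
    b₁+x+1≡ : suc (b₁ + x) ≡ b₁ + suc x
    b₁+x+1≡ = sym (+-suc b₁ x)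

  fPow-two-rows : ∀ {a₁ a₂} a₁′ b₁ a₂′ b₂ x y →
    a₁ ≡ a₁′ + x → a₂ ≡ a₂′ + y → b₂ ≤ a₁′ → y ≡ 0 ⊎ a₁′ ≤ b₂ →
    Transforms PairStrict (fPow (suc j) (y + x))
      (row₁ a₁ b₁ ∷ row₂ a₂ b₂ ∷ []) (row₁ a₁′ (b₁ + x) ∷ row₂ a₂′ (b₂ + y) ∷ [])
  fPow-two-rows {a₂ = a₂} a₁′ b₁ a₂′ b₂ x zero a₁≡ a₂≡ b₂≤a₁′ _ =
    transforms-≡ (cong₂ (λ a b → row₁ a₁′ (b₁ + x) ∷ row₂ a b ∷ []) (trans a₂≡ (+-identityʳ a₂′)) (sym (+-identityʳ b₂)))
      (fPow-top a₁′ b₁ a₂ b₂ x a₁≡ b₂≤a₁′)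
  fPow-two-rows a₁′ b₁ a₂′ b₂ x (suc y) a₁≡ a₂≡ b₂≤a₁′ (inj₂ a₁′≤b₂) .run cs
    with run (fPow-two-rows a₁′ b₁ (suc a₂′) b₂ x y a₁≡ (trans a₂≡ (+-suc a₂′ y)) b₂≤a₁′ (inj₂ a₁′≤b₂)) cs
  ... | computes , cs′ =
    trans (cong (_>>= fT (suc j)) computes)
      (trans (fT-bottom a₁′ (b₁ + x) a₂′ (b₂ + y) lo₁ hi₁ lo₂ hi₂ (≤-trans a₁′≤b₂ (m≤m+n b₂ y)))
             (cong (λ b → just (row₁ a₁′ (b₁ + x) ∷ row₂ a₂′ b ∷ [])) b₂+y+1≡)) ,
    subst (λ b → ColumnStrict (row₁ a₁′ (b₁ + x)) (row₂ a₂′ b)) b₂+y+1≡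
      (columnStrict-raise-bottom {row₁ a₁′ (b₁ + x)} (suc j) pre₂ a₂′ (b₂ + y) post₂ cs′)
    where
    b₂+y+1≡ : suc (b₂ + y) ≡ b₂ + suc y
    b₂+y+1≡ = sym (+-suc b₂ y)

climb : ∀ {pre₁ pre₂ G₁ G₂} x y j k →
  Below (suc j) pre₁ → Below (suc j) pre₂ → Above k G₁ → Above k G₂ → suc j ≤‴ suc k →
  Transforms PairStrict (applyAll (map (λ i → fPow i (y + x)) (fromTo (suc j) k)))
    ((pre₁ ++ replicate x (suc j) ++ G₁) ∷ (pre₂ ++ replicate y (suc j) ++ G₂) ∷ [])
    ((pre₁ ++ replicate x (suc k) ++ G₁) ∷ (pre₂ ++ replicate y (suc k) ++ G₂) ∷ [])
climb x y j .j lo₁ lo₂ hi₁ hi₂ ≤‴-refl rewrite fromTo-empty {suc j} {j} ≤-refl = transforms-just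
climb {pre₁} {pre₂} {G₁} {G₂} x y j k lo₁ lo₂ hi₁ hi₂ (≤‴-step j<k) =
  subst (λ L → Transforms PairStrict (applyAll (map (λ i → fPow i (y + x)) L)) _ _) (sym (fromTo-cons 1+j≤k))
    (transforms-∷ {gs = map (λ i → fPow i (y + x)) (fromTo (suc (suc j)) k)}
      (fPow-two-rows lo₁ (above-mono 1+j≤k hi₁) lo₂ (above-mono 1+j≤k hi₂) 0 0 0 0 x y refl refl z≤n (inj₂ z≤n))
      (climb x y (suc j) k (below-mono (n≤1+n _) lo₁) (below-mono (n≤1+n _) lo₂) hi₁ hi₂ j<k))
  where
  1+j≤k = ≤-pred (≤‴⇒≤ j<k)

climb-row : ∀ {pre G} x j k → Below (suc j) pre → Above k G → suc j ≤‴ suc k →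
  Transforms (λ _ → ⊤) (applyAll (map (λ i → fPow i x) (fromTo (suc j) k)))
    ((pre ++ replicate x (suc j) ++ G) ∷ []) ((pre ++ replicate x (suc k) ++ G) ∷ [])
climb-row x j .j lo hi ≤‴-refl rewrite fromTo-empty {suc j} {j} ≤-refl = transforms-just
climb-row x j k lo hi (≤‴-step j<k) =
  subst (λ L → Transforms (λ _ → ⊤) (applyAll (map (λ i → fPow i x) L)) _ _) (sym (fromTo-cons 1+j≤k))
    (transforms-∷ {g = fPow (suc j) x} {gs = map (λ i → fPow i x) (fromTo (suc (suc j)) k)}
      (transforms-⊤ (fPow-row 0 0 x lo (above-mono 1+j≤k hi) refl))
      (climb-row x (suc j) k (below-mono (n≤1+n _) lo) hi j<k))
  where
  1+j≤k = ≤-pred (≤‴⇒≤ j<k)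

module _ {P : Tableau → Set} (i n m : ℕ) (A : Array) (st : ℕ → Tableau) (l : ℕ)
         (G-step : Transforms P (Gop i n A) (T0 i m) (st (suc n)))
         (X-step : ∀ k → l ≤ k → k ≤ n → Transforms P (Xop i A k) (st (suc k)) (st k)) where

  private
    descent : ∀ k → l ≤ k → k ≤‴ suc n →
      Transforms P (applyAll (Gop i n A ∷ map (Xop i A) (reverse (fromTo k n)))) (T0 i m) (st k)
    descent .(suc n) l≤k ≤‴-refl rewrite fromTo-empty {suc n} {n} ≤-refl = transforms-∷ {gs = []} G-step transforms-just
    descent k l≤k (≤‴-step k<1+n)
      rewrite fromTo-cons (≤-pred (≤‴⇒≤ k<1+n)) | unfold-reverse k (fromTo (suc k) n)
            | map-++ (Xop i A) (reverse (fromTo (suc k) n)) (k ∷ []) =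
      transforms-++ (Gop i n A ∷ map (Xop i A) (reverse (fromTo (suc k) n))) (Xop i A k ∷ [])
        (descent (suc k) (m≤n⇒m≤1+n l≤k) k<1+n)
        (transforms-∷ {gs = []} (X-step k l≤k (≤-pred (≤‴⇒≤ k<1+n))) transforms-just)

  Tk-descent : P (T0 i m) → ∀ k → l ≤ k → k ≤ suc n → Tk i n m A k ≡ just (st k) × P (st k)
  Tk-descent p₀ k l≤k k≤1+n = run (descent k l≤k (≤⇒≤‴ k≤1+n)) p₀

ShapePreserving : (Tableau → Maybe Tableau) → Set
ShapePreserving g = ∀ {T T′} → g T ≡ just T′ → map length T′ ≡ map length T

length-setAt : ∀ w p v → length (setAt w p v) ≡ length w
length-setAt []      p       v = refl
length-setAt (x ∷ w) zero    v = refl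
length-setAt (x ∷ w) (suc p) v = cong suc (length-setAt w p v)

fWord-length : ∀ j w {w′} → fWord j w ≡ just w′ → length w′ ≡ length w
fWord-length j w with last (unpaired j 0 0 w)
... | nothing = λ ()
... | just p  = λ { refl → length-setAt w p (suc j) }

map-length-chunk : ∀ ls (w : List ℕ) → sum ls ≡ length w → map length (chunk ls w) ≡ ls
map-length-chunk []       w _     = refl
map-length-chunk (l ∷ ls) w l+≡ =
  cong₂ _∷_ (trans (length-take l w) (m≤n⇒m⊓n≡m l≤w))
            (map-length-chunk ls (drop l w) (sym (trans (length-drop l w) (trans (cong (_∸ l) (sym l+≡)) (m+n∸m≡n l (sum ls))))))
  where
  l≤w : l ≤ length w
  l≤w = subst (l ≤_) l+≡ (m≤m+n l (sum ls))

length-concat : ∀ (R : Tableau) → length (concat R) ≡ sum (map length R)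
length-concat []      = refl
length-concat (r ∷ R) = trans (length-++ r) (cong (length r +_) (length-concat R))

fT-shape : ∀ j → ShapePreserving (fT j)
fT-shape j {T} with fWord j (readWord T) in computes
... | nothing = λ ()
... | just w  = λ { refl → begin
  map length (reverse (chunk (map length (reverse T)) w))   ≡⟨ reverse-map length (chunk (map length (reverse T)) w) ⟩
  reverse (map length (chunk (map length (reverse T)) w))   ≡⟨ cong reverse (map-length-chunk (map length (reverse T)) w lengths) ⟩
  reverse (map length (reverse T))                          ≡⟨ cong reverse (reverse-map length T) ⟩
  reverse (reverse (map length T))                          ≡⟨ reverse-involutive (map length T) ⟩
  map length T                                              ∎ }
  where
  open ≡-Reasoning
  lengths : sum (map length (reverse T)) ≡ length w
  lengths = trans (sym (length-concat (reverse T))) (sym (fWord-length j (readWord T) computes))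

>>=-shape : ∀ {g h} → ShapePreserving g → ShapePreserving h → ShapePreserving (λ T → g T >>= h)
>>=-shape {g} {h} g-shape h-shape {T} with g T in computes
... | nothing = λ ()
... | just T₁ = λ h-computes → trans (h-shape h-computes) (g-shape computes)

fPow-shape : ∀ j c → ShapePreserving (fPow j c)
fPow-shape j zero    refl = refl
fPow-shape j (suc c) = >>=-shape (fPow-shape j c) (fT-shape j)

applyAll-shape : ∀ gs → All ShapePreserving gs → ShapePreserving (applyAll gs)
applyAll-shape []       []       refl = refl
applyAll-shape (g ∷ gs) (p ∷ ps) = >>=-shape p (applyAll-shape gs ps)

all-shape-preserving : ∀ (f : ℕ → Tableau → Maybe Tableau) js → (∀ j → ShapePreserving (f j)) → All ShapePreserving (map f js)
all-shape-preserving f js f-shape = map⁺ (All.universal {P = ShapePreserving ∘ f} f-shape js)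

Dop-shape : ∀ i A ℓ → ShapePreserving (Dop i A ℓ)
Dop-shape 2 A ℓ = fPow-shape 2 (A 2 ℓ)
Dop-shape 0 A ℓ refl = refl
Dop-shape 1 A ℓ refl = refl
Dop-shape (suc (suc (suc i))) A ℓ refl = refl

Xop-shape : ∀ i A ℓ → ShapePreserving (Xop i A ℓ)
Xop-shape i A ℓ = applyAll-shape _ (Dop-shape i A ℓ ∷ all-shape-preserving _ (fromTo (suc i) ℓ) (λ j → fPow-shape j (cc i A ℓ)))

Gop-shape : ∀ i n A → ShapePreserving (Gop i n A)
Gop-shape i n A = applyAll-shape _ (all-shape-preserving _ (reverse (fromTo 1 i)) (λ j → fPow-shape j (sumN i n (λ r → A 1 r))))

Tk-shape : ∀ i n m A k {T} → Tk i n m A k ≡ just T → map length T ≡ map length (T0 i m)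
Tk-shape i n m A k = applyAll-shape _ (Gop-shape i n A ∷ all-shape-preserving (Xop i A) (reverse (fromTo k n)) (Xop-shape i A))

blocks : (ℕ → ℕ) → ℕ → ℕ → List ℕ
blocks f v zero    = []
blocks f v (suc r) = replicate (f v) (suc v) ++ blocks f (suc v) r

blocks-unfold : ∀ f {k n} → k ≤ n → blocks f k (suc n ∸ k) ≡ replicate (f k) (suc k) ++ blocks f (suc k) (n ∸ k)
blocks-unfold f k≤n rewrite +-∸-assoc 1 k≤n = refl

blocks-end : ∀ f n → blocks f (suc n) (n ∸ n) ≡ []
blocks-end f n rewrite n∸n≡0 n = refl

blocks-≥ : ∀ f v r → All (suc v ≤_) (blocks f v r)
blocks-≥ f v zero    = []
blocks-≥ f v (suc r) = ++⁺ (All-replicate (f v) ≤-refl) (All.map (≤-trans (n≤1+n _)) (blocks-≥ f (suc v) r))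

blocks-≤ : ∀ f v r → All (_≤ v + r) (blocks f v r)
blocks-≤ f v zero    = []
blocks-≤ f v (suc r) rewrite +-suc v r =
  ++⁺ (All-replicate (f v) (s≤s (m≤m+n v r))) (blocks-≤ f (suc v) r)

blocks-above : ∀ {j} f v r → j < v → Above j (blocks f v r)
blocks-above f v r j<v = All.map (<-≤-trans (s≤s j<v)) (blocks-≥ f v r)

data AscendingFrom : ℕ → List ℕ → Set where
  []  : ∀ {v} → AscendingFrom v []
  _∷_ : ∀ {v x xs} → v ≤ x → AscendingFrom x xs → AscendingFrom v (x ∷ xs)

ascending-weaken : ∀ {v w xs} → v ≤ w → AscendingFrom w xs → AscendingFrom v xs
ascending-weaken v≤w []         = []
ascending-weaken v≤w (w≤x ∷ xs) = ≤-trans v≤w w≤x ∷ xs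

ascending-replicate-++ : ∀ {v x ys} a → v ≤ x → AscendingFrom x ys → AscendingFrom v (replicate a x ++ ys)
ascending-replicate-++ zero    v≤x ys = ascending-weaken v≤x ys
ascending-replicate-++ (suc a) v≤x ys = v≤x ∷ ascending-replicate-++ a ≤-refl ys

ascending-blocks : ∀ f v r → AscendingFrom (suc v) (blocks f v r)
ascending-blocks f v zero    = []
ascending-blocks f v (suc r) = ascending-replicate-++ (f v) ≤-refl (ascending-weaken (n≤1+n _) (ascending-blocks f (suc v) r))

ascending-lower : ∀ {v xs} c → AscendingFrom v xs → c < length xs → v ≤ nth 0 xs c
ascending-lower zero    (v≤x ∷ _)  _           = v≤x
ascending-lower (suc c) (v≤x ∷ xs) (s≤s c<xs) = ≤-trans v≤x (ascending-lower c xs c<xs)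

ascending-step : ∀ {v xs} c → AscendingFrom v xs → suc c < length xs → nth 0 xs c ≤ nth 0 xs (suc c)
ascending-step zero    (_ ∷ xs) (s≤s 1<xs) = ascending-lower 0 xs 1<xs
ascending-step (suc c) (_ ∷ xs) (s≤s c<xs) = ascending-step c xs c<xs

ascending-all : ∀ {v xs} → AscendingFrom v xs → All (v ≤_) xs
ascending-all []         = []
ascending-all (v≤x ∷ xs) = v≤x ∷ All.map (≤-trans v≤x) (ascending-all xs)

All-nth : ∀ {P : ℕ → Set} {xs} c → All P xs → c < length xs → P (nth 0 xs c)
All-nth zero    (px ∷ _)   _           = px
All-nth (suc c) (_ ∷ pxs) (s≤s c<xs) = All-nth c pxs c<xs

atMost-<-nth : ∀ {v xs} w c → AscendingFrom v xs → c < length xs → w < nth 0 xs c → atMost w xs ≤ c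
atMost-<-nth w zero    (_ ∷ xs) _ w<x =
  ≤-reflexive (atMost-none (All.map (<-≤-trans w<x) (ascending-all (≤-refl ∷ xs))))
atMost-<-nth w (suc c) (_∷_ {x = x} _ xs) (s≤s c<xs) w<nth =
  ≤-trans (atMost-∷-≤ w x _) (s≤s (atMost-<-nth w c xs c<xs w<nth))

nth-≤⇒atMost : ∀ {v xs} w c → AscendingFrom v xs → c < length xs → nth 0 xs c ≤ w → suc c ≤ atMost w xs
nth-≤⇒atMost w zero    (_ ∷ xs) _ x≤w = ≤-trans (s≤s z≤n) (≤-reflexive (sym (atMost-accept _ x≤w)))
nth-≤⇒atMost w (suc c) (_ ∷ xs) (s≤s c<xs) nth≤w =
  ≤-trans (s≤s (nth-≤⇒atMost w c xs c<xs nth≤w))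
          (≤-reflexive (sym (atMost-accept _ (≤-trans (ascending-lower c xs c<xs) nth≤w))))

columnStrict⇒< : ∀ {r₁ r₂} c → ColumnStrict r₁ r₂ → AscendingFrom 1 r₁ → AscendingFrom 1 r₂ →
  c < length r₁ → c < length r₂ → nth 0 r₁ c < nth 0 r₂ c
columnStrict⇒< {r₁} {r₂} c cs asc₁ asc₂ c<r₁ c<r₂ with nth 0 r₁ c in x≡ | ascending-lower c asc₁ c<r₁
... | suc x | _ with suc x <? nth 0 r₂ c
...   | yes lt = lt
...   | no ≮  = ⊥-elim (1+n≰n (begin
  suc c                      ≤⟨ nth-≤⇒atMost (suc x) c asc₂ c<r₂ (≮⇒≥ ≮) ⟩
  atMost (suc x) r₂          ≤⟨ cs x ⟩
  atMost x r₁                ≤⟨ atMost-<-nth x c asc₁ c<r₁ (≤-reflexive (sym x≡)) ⟩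
  c                          ∎))
  where open ≤-Reasoning

ssyt-one-row : ∀ {n m r} → length r ≡ m → AscendingFrom 1 r → All (_≤ suc n) r → IsSSYT 1 n m (r ∷ [])
ssyt-one-row {n} {r = r} refl asc bounded = refl , refl ∷ [] , rows , (λ { _ _ (s≤s ()) _ }) , entries
  where
  rows : ∀ s c → s < 1 → suc c < length r → ent (r ∷ []) s c ≤ ent (r ∷ []) s (suc c)
  rows zero c _ 1+c<m = ascending-step c asc 1+c<m
  rows (suc s) c (s≤s ()) _
  entries : ∀ s c → s < 1 → c < length r → 1 ≤ ent (r ∷ []) s c × ent (r ∷ []) s c ≤ suc n
  entries zero c _ c<m = ascending-lower c asc c<m , All-nth c bounded c<m
  entries (suc s) c (s≤s ()) _

ssyt-two-rows : ∀ {n m r₁ r₂} → length r₁ ≡ m → length r₂ ≡ m → AscendingFrom 1 r₁ → AscendingFrom 1 r₂ →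
  All (_≤ suc n) r₁ → All (_≤ suc n) r₂ → ColumnStrict r₁ r₂ → IsSSYT 2 n m (r₁ ∷ r₂ ∷ [])
ssyt-two-rows {n} {m} {r₁} {r₂} refl len₂ asc₁ asc₂ bounded₁ bounded₂ cs = refl , refl ∷ len₂ ∷ [] , rows , columns , entries
  where
  R = r₁ ∷ r₂ ∷ []
  rows : ∀ s c → s < 2 → suc c < m → ent R s c ≤ ent R s (suc c)
  rows zero          c _ 1+c<m = ascending-step c asc₁ 1+c<m
  rows (suc zero)    c _ 1+c<m = ascending-step c asc₂ (subst (suc c <_) (sym len₂) 1+c<m)
  rows (suc (suc s)) c (s≤s (s≤s ())) _
  columns : ∀ s c → suc s < 2 → c < m → ent R s c < ent R (suc s) c
  columns zero c _ c<m = columnStrict⇒< c cs asc₁ asc₂ c<m (subst (c <_) (sym len₂) c<m)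
  columns (suc s) c (s≤s (s≤s ())) _
  entries : ∀ s c → s < 2 → c < m → 1 ≤ ent R s c × ent R s c ≤ suc n
  entries zero          c _ c<m = ascending-lower c asc₁ c<m , All-nth c bounded₁ c<m
  entries (suc zero)    c _ c<m = ascending-lower c asc₂ c<m₂ , All-nth c bounded₂ c<m₂
    where
    c<m₂ = subst (c <_) (sym len₂) c<m
  entries (suc (suc s)) c (s≤s (s≤s ())) _

count-none : ∀ {v xs} → All (_≢ v) xs → count v xs ≡ 0
count-none {v} none = cong length (filter-none (T? ∘ (_≡ᵇ v)) (All.map (λ {x} x≢v t → x≢v (≡ᵇ⇒≡ x v t)) none))

count-replicate-++ : ∀ v a ys → count v (replicate a v ++ ys) ≡ a + count v ys
count-replicate-++ v zero    ys = refl
count-replicate-++ v (suc a) ys =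
  trans (cong length (filter-accept (T? ∘ (_≡ᵇ v)) {x = v} {xs = replicate a v ++ ys} (≡⇒≡ᵇ v v refl)))
        (cong suc (count-replicate-++ v a ys))

count-replicate-≢-++ : ∀ {v x} a ys → x ≢ v → count v (replicate a x ++ ys) ≡ count v ys
count-replicate-≢-++ zero    ys x≢v = refl
count-replicate-≢-++ {v} {x} (suc a) ys x≢v =
  trans (cong length (filter-reject (T? ∘ (_≡ᵇ v)) {x = x} {xs = replicate a x ++ ys} (λ t → x≢v (≡ᵇ⇒≡ x v t))))
        (count-replicate-≢-++ a ys x≢v)

count-blocks-≤ : ∀ f {w} v r → w ≤ v → count w (blocks f v r) ≡ 0
count-blocks-≤ f v r w≤v = count-none (All.map (λ 1+v≤x x≡w → <⇒≱ 1+v≤x (≤-trans (≤-reflexive x≡w) w≤v)) (blocks-≥ f v r))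

count-blocks : ∀ f {w} v r → v < w → w ≤ v + r → count w (blocks f v r) ≡ f (w ∸ 1)
count-blocks f {w} v zero    v<w w≤v+0 = ⊥-elim (<⇒≱ v<w (≤-trans w≤v+0 (≤-reflexive (+-identityʳ v))))
count-blocks f {w} v (suc r) v<w w≤v+1+r with w ≟ suc v
... | yes refl = trans (count-replicate-++ (suc v) (f v) _) (trans (cong (f v +_) (count-blocks-≤ f (suc v) r ≤-refl)) (+-identityʳ (f v)))
... | no w≢1+v  = trans (count-replicate-≢-++ (f v) _ (≢-sym w≢1+v))
                        (count-blocks f (suc v) r (≤∧≢⇒< v<w (≢-sym w≢1+v)) (≤-trans w≤v+1+r (≤-reflexive (+-suc v r))))

m>n⇒m∸n≡1+[m∸1+n] : ∀ {m n} → n < m → m ∸ n ≡ suc (m ∸ suc n)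
m>n⇒m∸n≡1+[m∸1+n] {suc m} {zero}  _         = refl
m>n⇒m∸n≡1+[m∸1+n] {suc m} {suc n} (s≤s n<m) = m>n⇒m∸n≡1+[m∸1+n] n<m

m>n⇒m∸[1+[m∸1+n]]≡n : ∀ {m n} → n < m → m ∸ suc (m ∸ suc n) ≡ n
m>n⇒m∸[1+[m∸1+n]]≡n {m} n<m = trans (cong (m ∸_) (sym (m>n⇒m∸n≡1+[m∸1+n] n<m))) (m∸[m∸n]≡n (<⇒≤ n<m))

-- (u , ν) = ((1 - χ) Σ , - χ Σ) = (max(Σ, 0) , max(- Σ, 0)), indexed like SC
UV : Array → ℕ → ℕ → ℕ × ℕ
UV A n zero    = 0 , A 2 n
UV A n (suc d) = s ∸ A 2 k , A 2 k ∸ s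
  where
  k = n ∸ suc d
  s = A 1 (suc k) + proj₁ (UV A n d)

module _ where
  open import Data.Integer as ℤ using (ℤ; +_; -[1+_]; -_; _-_; _*_)
  import Data.Integer.Properties as ℤᵖ

  chi-split : ∀ p b → ((+ 1 - chi (+ p - + b)) * (+ p - + b) ≡ + (p ∸ b)) × (chi (+ p - + b) * (+ p - + b) ≡ - (+ (b ∸ p)))
  chi-split p b rewrite ℤᵖ.[+m]-[+n]≡m⊖n p b with b ≤? p
  ... | yes b≤p rewrite ℤᵖ.⊖-≥ b≤p | m≤n⇒m∸n≡0 b≤p = ℤᵖ.*-identityˡ (+ (p ∸ b)) , refl
  ... | no b≰p with b ∸ p in b∸p≡
  ...   | zero  = ⊥-elim (b≰p (m∸n≡0⇒m≤n b∸p≡))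
  ...   | suc t rewrite ℤᵖ.⊖-< (≰⇒> b≰p) | b∸p≡ | m≤n⇒m∸n≡0 (<⇒≤ (≰⇒> b≰p)) = refl , ℤᵖ.*-identityˡ -[1+ t ]

  SC-UV : ∀ A n d → ((+ 1 - proj₂ (SC A n d)) * proj₁ (SC A n d) ≡ + proj₁ (UV A n d))
                  × (proj₂ (SC A n d) * proj₁ (SC A n d) ≡ - (+ proj₂ (UV A n d)))
  SC-UV A n zero    = refl , ℤᵖ.*-identityˡ (- (+ A 2 n))
  SC-UV A n (suc d) rewrite proj₁ (SC-UV A n d) | sym (ℤᵖ.pos-+ (A 1 (suc (n ∸ suc d))) (proj₁ (UV A n d))) =
    chi-split (A 1 (suc (n ∸ suc d)) + proj₁ (UV A n d)) (A 2 (n ∸ suc d))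

  pos-∸ : ∀ {a b} → b ≤ a → + (a ∸ b) ≡ + a - + b
  pos-∸ {a} {b} b≤a = sym (trans (ℤᵖ.[+m]-[+n]≡m⊖n a b) (ℤᵖ.⊖-≥ b≤a))

  sumZ-neg : ∀ lo hi {g : ℕ → ℤ} {f} → (∀ j → g j ≡ - (+ f j)) → sumZ lo hi g ≡ - (+ sumN lo hi f)
  sumZ-neg lo hi {f = f} g≡ = trans (cong (foldr ℤ._+_ (+ 0)) (map-cong g≡ (fromTo lo hi))) (foldr-neg (fromTo lo hi))
    where
    foldr-neg : ∀ js → foldr ℤ._+_ (+ 0) (map (λ j → - (+ f j)) js) ≡ - (+ sum (map f js))
    foldr-neg []       = refl
    foldr-neg (j ∷ js) = trans (cong (ℤ._+_ (- (+ f j))) (foldr-neg js))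
      (sym (trans (cong -_ (ℤᵖ.pos-+ (f j) (sum (map f js)))) (ℤᵖ.neg-distrib-+ (+ f j) (+ sum (map f js)))))

-- The case i = 2

module TwoRows (n m : ℕ) (A : Array) (a₁₁≡0 : A 1 1 ≡ 0) (a₁,₁₊ₙ≡0 : A 1 (suc n) ≡ 0)
               (paths : ∀ (β : DyckPath 2 n) → pathSum A β ≤ m) where

  S : ℕ → ℕ
  S k = sumN 1 k (A 1)

  u ν : ℕ → ℕ
  u k = proj₁ (UV A n (n ∸ k))
  ν k = proj₂ (UV A n (n ∸ k))

  -- Σ k = s k - A 2 k
  s : ℕ → ℕ
  s k = A 1 (suc k) + u (suc k)

  S-suc : ∀ k → S (suc k) ≡ S k + A 1 (suc k)
  S-suc k = sumN-snoc (A 1) (s≤s z≤n)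

  S-1 : S 1 ≡ 0
  S-1 = trans (sumN-single 1 (A 1)) a₁₁≡0

  sumN-2≡S : ∀ k → 1 ≤ k → sumN 2 k (A 1) ≡ S k
  sumN-2≡S k 1≤k = sym (trans (sumN-cons (A 1) 1≤k) (cong (_+ sumN 2 k (A 1)) a₁₁≡0))

  UV-step : ∀ k → k ≤ n → u k ≡ s k ∸ A 2 k × ν k ≡ A 2 k ∸ s k
  UV-step k k≤n with m≤n⇒m<n∨m≡n k≤n
  ... | inj₁ k<n rewrite m>n⇒m∸n≡1+[m∸1+n] k<n | m>n⇒m∸[1+[m∸1+n]]≡n k<n = refl , refl
  ... | inj₂ refl rewrite n∸n≡0 n | m≤n⇒m∸n≡0 (n≤1+n n) | a₁,₁₊ₙ≡0 | 0∸n≡0 (A 2 n) = refl , refl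

  ν≤A₂ : ∀ k → k ≤ n → ν k ≤ A 2 k
  ν≤A₂ k k≤n rewrite proj₂ (UV-step k k≤n) = m∸n≤m (A 2 k) (s k)

  ν+s≡A₂+u : ∀ k → k ≤ n → ν k + s k ≡ A 2 k + u k
  ν+s≡A₂+u k k≤n rewrite proj₁ (UV-step k k≤n) | proj₂ (UV-step k k≤n) with s k ≤? A 2 k
  ... | yes s≤a rewrite m≤n⇒m∸n≡0 s≤a = trans (m∸n+n≡m s≤a) (sym (+-identityʳ (A 2 k)))
  ... | no s≰a rewrite m≤n⇒m∸n≡0 (<⇒≤ (≰⇒> s≰a)) = sym (m+[n∸m]≡n (<⇒≤ (≰⇒> s≰a)))

  N B Φ : ℕ → ℕ
  N k = sumN k n ν
  B k = sumN k n (A 2)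
  Φ k = S k + B k + u k

  u-n : u n ≡ 0
  u-n rewrite n∸n≡0 n = refl

  ν-n : ν n ≡ A 2 n
  ν-n rewrite n∸n≡0 n = refl

  N-cons : ∀ k → k ≤ n → N k ≡ ν k + N (suc k)
  N-cons k = sumN-cons ν

  B-cons : ∀ k → k ≤ n → B k ≡ A 2 k + B (suc k)
  B-cons k = sumN-cons (A 2)

  S+N≡Φ : ∀ k → k ≤‴ n → S n + N k ≡ Φ k
  S+N≡Φ k ≤‴-refl = begin
    S n + N n                 ≡⟨ cong (S n +_) (trans (N-cons n ≤-refl) (cong₂ _+_ ν-n (sumN-empty {suc n} {n} ν ≤-refl))) ⟩
    S n + (A 2 n + 0)         ≡⟨ cong (S n +_) (sym (trans (B-cons n ≤-refl) (cong (A 2 n +_) (sumN-empty {suc n} {n} (A 2) ≤-refl)))) ⟩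
    S n + B n                 ≡⟨ sym (+-identityʳ _) ⟩
    S n + B n + 0             ≡⟨ cong (S n + B n +_) (sym u-n) ⟩
    Φ n                       ∎
    where open ≡-Reasoning
  S+N≡Φ k (≤‴-step k<n) = begin
    S n + N k                                    ≡⟨ cong (S n +_) (N-cons k k≤n) ⟩
    S n + (ν k + N (suc k))                      ≡⟨ x∙yz≈y∙xz (S n) (ν k) (N (suc k)) ⟩
    ν k + (S n + N (suc k))                      ≡⟨ cong (ν k +_) (S+N≡Φ (suc k) k<n) ⟩
    ν k + (S (suc k) + B (suc k) + u (suc k))    ≡⟨ cong (λ z → ν k + (z + B (suc k) + u (suc k))) (S-suc k) ⟩
    ν k + (S k + A 1 (suc k) + B (suc k) + u (suc k))
                                                 ≡⟨ shuffle₂ (ν k) (S k) (A 1 (suc k)) (B (suc k)) (u (suc k)) ⟩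
    S k + B (suc k) + (ν k + s k)                ≡⟨ cong (S k + B (suc k) +_) (ν+s≡A₂+u k k≤n) ⟩
    S k + B (suc k) + (A 2 k + u k)              ≡⟨ shuffle₃ (S k) (B (suc k)) (A 2 k) (u k) ⟩
    S k + (A 2 k + B (suc k)) + u k              ≡⟨ cong (λ z → S k + z + u k) (sym (B-cons k k≤n)) ⟩
    Φ k                                          ∎
    where
    open ≡-Reasoning
    k≤n = <⇒≤ (≤‴⇒≤ k<n)
    shuffle₂ : ∀ v a b c d → v + (a + b + c + d) ≡ a + c + (v + (b + d))
    shuffle₂ = solve-∀
    shuffle₃ : ∀ a b c d → a + b + (c + d) ≡ a + (c + b) + d
    shuffle₃ = solve-∀

  path-bound : ∀ q → 2 ≤ q → q ≤ n → S q + B q ≤ m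
  path-bound q 2≤q q≤n = subst (_≤ m) sum-path (paths path)
    where
    path : DyckPath 2 n
    path = column-then-right (≤⇒≤‴ 2≤q) (column (≤⇒≤‴ q≤n))
    sum-path : pathSum A path ≡ S q + B q
    sum-path = trans (pathSum-column-then-right A (≤⇒≤‴ 2≤q) _)
      (cong₂ _+_ (sumN-2≡S q (≤-trans (s≤s z≤n) 2≤q)) (pathSum-column A (≤⇒≤‴ q≤n)))

  -- If u k ≡ 0 then Φ k is the weight of the Dyck path turning right at row k, otherwise Φ k ≡ Φ (suc k).
  Φ≤m : ∀ k → 2 ≤ k → k ≤‴ n → Φ k ≤ m
  Φ≤m k 2≤k ≤‴-refl = subst (_≤ m) (trans (sym (+-identityʳ _)) (cong (S n + B n +_) (sym u-n))) (path-bound n 2≤k ≤-refl)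
  Φ≤m k 2≤k (≤‴-step k<n) with s k ≤? A 2 k
  ... | yes s≤a = subst (_≤ m) (trans (sym (+-identityʳ _)) (cong (S k + B k +_) (sym u≡0))) (path-bound k 2≤k k≤n)
    where
    k≤n = <⇒≤ (≤‴⇒≤ k<n)
    u≡0 : u k ≡ 0
    u≡0 = trans (proj₁ (UV-step k k≤n)) (m≤n⇒m∸n≡0 s≤a)
  ... | no s≰a = subst (_≤ m) (sym Φ-k≡Φ-1+k) (Φ≤m (suc k) (m≤n⇒m≤1+n 2≤k) k<n)
    where
    open ≡-Reasoning
    k≤n = <⇒≤ (≤‴⇒≤ k<n)
    Φ-k≡Φ-1+k : Φ k ≡ Φ (suc k)
    Φ-k≡Φ-1+k = begin
      S k + B k + u k                                ≡⟨ cong₂ (λ b v → S k + b + v) (B-cons k k≤n) (proj₁ (UV-step k k≤n)) ⟩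
      S k + (A 2 k + B (suc k)) + (s k ∸ A 2 k)      ≡⟨ shuffle (S k) (A 2 k) (B (suc k)) (s k ∸ A 2 k) ⟩
      S k + B (suc k) + (A 2 k + (s k ∸ A 2 k))      ≡⟨ cong (S k + B (suc k) +_) (m+[n∸m]≡n (<⇒≤ (≰⇒> s≰a))) ⟩
      S k + B (suc k) + (A 1 (suc k) + u (suc k))    ≡⟨ shuffle′ (S k) (B (suc k)) (A 1 (suc k)) (u (suc k)) ⟩
      S k + A 1 (suc k) + B (suc k) + u (suc k)      ≡⟨ cong (λ z → z + B (suc k) + u (suc k)) (sym (S-suc k)) ⟩
      Φ (suc k)                                      ∎
      where
      shuffle : ∀ a b c d → a + (b + c) + d ≡ a + c + (b + d)
      shuffle = solve-∀
      shuffle′ : ∀ a b c d → a + b + (c + d) ≡ a + c + b + d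
      shuffle′ = solve-∀

  S+N≤m : ∀ k → 2 ≤ k → k ≤ n → S n + N k ≤ m
  S+N≤m k 2≤k k≤n = subst (_≤ m) (sym (S+N≡Φ k (≤⇒≤‴ k≤n))) (Φ≤m k 2≤k (≤⇒≤‴ k≤n))

  top bottom : ℕ → ℕ
  top k    = A 2 k ∸ ν k
  bottom k = A 1 k + ν k

  α : ℕ
  α = m ∸ S n

  P β : ℕ → ℕ
  P k = S k + u k
  β k = m ∸ (S n + N k)

  rowTop rowBottom : ℕ → List ℕ
  rowTop k    = replicate α 1 ++ replicate (P k) 2 ++ blocks top k (suc n ∸ k)
  rowBottom k = replicate (β k) 2 ++ replicate (S (k ∸ 1)) 3 ++ blocks bottom k (suc n ∸ k)

  tableau : ℕ → Tableau
  tableau k = rowTop k ∷ rowBottom k ∷ []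

  A₂≡ν+top : ∀ k → k ≤ n → A 2 k ≡ ν k + top k
  A₂≡ν+top k k≤n = sym (m+[n∸m]≡n (ν≤A₂ k k≤n))

  P-suc : ∀ k → k ≤ n → P (suc k) ≡ P k + top k
  P-suc k k≤n = begin
    S (suc k) + u (suc k)        ≡⟨ cong (_+ u (suc k)) (S-suc k) ⟩
    S k + A 1 (suc k) + u (suc k) ≡⟨ +-assoc (S k) _ _ ⟩
    S k + s k                    ≡⟨ cong (S k +_) s≡u+top ⟩
    S k + (u k + top k)          ≡⟨ sym (+-assoc (S k) _ _) ⟩
    P k + top k                  ∎
    where
    open ≡-Reasoning
    s≡u+top : s k ≡ u k + top k
    s≡u+top = +-cancelˡ-≡ (ν k) _ _ (begin
      ν k + s k                  ≡⟨ ν+s≡A₂+u k k≤n ⟩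
      A 2 k + u k                ≡⟨ cong (_+ u k) (A₂≡ν+top k k≤n) ⟩
      ν k + top k + u k          ≡⟨ +-assoc (ν k) _ _ ⟩
      ν k + (top k + u k)        ≡⟨ cong (ν k +_) (+-comm (top k) (u k)) ⟩
      ν k + (u k + top k)        ∎)

  β-suc : ∀ k → 2 ≤ k → k ≤ n → β (suc k) ≡ β k + ν k
  β-suc k 2≤k k≤n = begin
    m ∸ X                        ≡⟨ sym (m∸n+n≡m ν≤m∸X) ⟩
    m ∸ X ∸ ν k + ν k            ≡⟨ cong (_+ ν k) (∸-+-assoc m X (ν k)) ⟩
    m ∸ (X + ν k) + ν k          ≡⟨ cong (λ z → m ∸ z + ν k) X+ν≡S+N ⟩
    β k + ν k                    ∎
    where
    open ≡-Reasoning
    X = S n + N (suc k)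
    ν+X≡S+N : ν k + X ≡ S n + N k
    ν+X≡S+N = trans (x∙yz≈y∙xz (ν k) (S n) _) (cong (S n +_) (sym (N-cons k k≤n)))
    X+ν≡S+N : X + ν k ≡ S n + N k
    X+ν≡S+N = trans (+-comm X (ν k)) ν+X≡S+N
    ν≤m∸X : ν k ≤ m ∸ X
    ν≤m∸X = m+n≤o⇒m≤o∸n (ν k) (subst (_≤ m) (sym ν+X≡S+N) (S+N≤m k 2≤k k≤n))

  ν≡0⊎u≡0 : ∀ k → k ≤ n → ν k ≡ 0 ⊎ u k ≡ 0
  ν≡0⊎u≡0 k k≤n with s k ≤? A 2 k
  ... | yes s≤a = inj₂ (trans (proj₁ (UV-step k k≤n)) (m≤n⇒m∸n≡0 s≤a))
  ... | no s≰a  = inj₁ (trans (proj₂ (UV-step k k≤n)) (m≤n⇒m∸n≡0 (<⇒≤ (≰⇒> s≰a))))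

  afterD : ℕ → Tableau
  afterD k = row 2 (replicate α 1) (P k) (top k) (blocks top (suc k) (n ∸ k))
           ∷ row 2 [] (β k) (S k + ν k) (blocks bottom (suc k) (n ∸ k)) ∷ []

  D-step : ∀ k → 2 ≤ k → k ≤ n → Transforms PairStrict (fPow 2 (A 2 k)) (tableau (suc k)) (afterD k)
  D-step k 2≤k k≤n =
    subst (λ c → Transforms PairStrict (fPow 2 c) (tableau (suc k)) (afterD k)) (sym (A₂≡ν+top k k≤n))
      (fPow-two-rows (All-replicate α (s≤s (s≤s z≤n))) (blocks-above top (suc k) (n ∸ k) (s≤s 2≤k))
                     [] (blocks-above bottom (suc k) (n ∸ k) (s≤s 2≤k))
                     (P k) 0 (β k) (S k) (top k) (ν k) (P-suc k k≤n) (β-suc k 2≤k k≤n) (m≤m+n (S k) (u k)) ν≡0⊎P≤S)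
    where
    ν≡0⊎P≤S : ν k ≡ 0 ⊎ P k ≤ S k
    ν≡0⊎P≤S with ν≡0⊎u≡0 k k≤n
    ... | inj₁ ν≡0 = inj₁ ν≡0
    ... | inj₂ u≡0 = inj₂ (≤-reflexive (trans (cong (S k +_) u≡0) (+-identityʳ (S k))))

  cc≡bottom+top : ∀ k → k ≤ n → cc 2 A k ≡ bottom k + top k
  cc≡bottom+top k k≤n = begin
    A 1 k + (A 2 k + 0)        ≡⟨ cong (A 1 k +_) (trans (+-identityʳ (A 2 k)) (A₂≡ν+top k k≤n)) ⟩
    A 1 k + (ν k + top k)      ≡⟨ sym (+-assoc (A 1 k) _ _) ⟩
    bottom k + top k           ∎
    where open ≡-Reasoning

  -- tableau k, except that the two blocks of letters k+1 still consist of letters j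
  tableauWith : ℕ → ℕ → Tableau
  tableauWith k j = ((replicate α 1 ++ replicate (P k) 2) ++ replicate (top k) j ++ blocks top (suc k) (n ∸ k))
                  ∷ ((replicate (β k) 2 ++ replicate (S (k ∸ 1)) 3) ++ replicate (bottom k) j ++ blocks bottom (suc k) (n ∸ k)) ∷ []

  tableau-unfold : ∀ k → k ≤ n → tableau k ≡ tableauWith k (suc k)
  tableau-unfold k k≤n rewrite blocks-unfold top k≤n | blocks-unfold bottom k≤n =
    cong₂ (λ r₁ r₂ → r₁ ∷ r₂ ∷ []) (sym (++-assoc (replicate α 1) _ _)) (sym (++-assoc (replicate (β k) 2) _ _))

  afterD-2 : afterD 2 ≡ tableauWith 2 3
  afterD-2 = cong₂ (λ r₁ r₂ → r₁ ∷ r₂ ∷ []) (sym (++-assoc (replicate α 1) _ _)) (begin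
    replicate (β 2) 2 ++ replicate (S 2 + ν 2) 3 ++ G₂
      ≡⟨ cong (λ z → replicate (β 2) 2 ++ replicate z 3 ++ G₂) S₂+ν≡bottom ⟩
    replicate (β 2) 2 ++ replicate (bottom 2) 3 ++ G₂
      ≡⟨ cong (λ z → replicate (β 2) 2 ++ replicate z 3 ++ replicate (bottom 2) 3 ++ G₂) (sym S-1) ⟩
    replicate (β 2) 2 ++ replicate (S 1) 3 ++ replicate (bottom 2) 3 ++ G₂    ≡⟨ sym (++-assoc (replicate (β 2) 2) _ _) ⟩
    (replicate (β 2) 2 ++ replicate (S 1) 3) ++ replicate (bottom 2) 3 ++ G₂  ∎)
    where
    open ≡-Reasoning
    G₂ = blocks bottom 3 (n ∸ 2)
    S₂+ν≡bottom : S 2 + ν 2 ≡ bottom 2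
    S₂+ν≡bottom = cong (_+ ν 2) (trans (S-suc 1) (cong (_+ A 1 2) S-1))

  f₃-step : ∀ k → 3 ≤ k → Transforms PairStrict (fPow 3 (bottom k + top k)) (afterD k) (tableauWith k 4)
  f₃-step k@(suc k″) 3≤k =
    transforms-cong (cong (_∷ row₂ (S k + ν k) 0 ∷ []) (++-assoc (replicate α 1) _ _))
                    (cong (λ r → row₁ 0 (top k) ∷ r ∷ []) (sym (++-assoc (replicate (β k) 2) _ _)))
      (fPow-two-rows below₁ (blocks-above top (suc k) (n ∸ k) (s≤s 3≤k)) below₂ (blocks-above bottom (suc k) (n ∸ k) (s≤s 3≤k))
                     0 0 (S k″) 0 (top k) (bottom k) refl a₂≡ z≤n (inj₂ z≤n))
    where
    row₁ row₂ : ℕ → ℕ → List ℕ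
    row₁ a b = row 3 (replicate α 1 ++ replicate (P k) 2) a b (blocks top (suc k) (n ∸ k))
    row₂ a b = row 3 (replicate (β k) 2) a b (blocks bottom (suc k) (n ∸ k))
    below₁ : Below 3 (replicate α 1 ++ replicate (P k) 2)
    below₁ = ++⁺ (All-replicate α (s≤s (s≤s z≤n))) (All-replicate (P k) ≤-refl)
    below₂ : Below 3 (replicate (β k) 2)
    below₂ = All-replicate (β k) ≤-refl
    a₂≡ : S k + ν k ≡ S k″ + bottom k
    a₂≡ = trans (cong (_+ ν k) (S-suc k″)) (+-assoc (S k″) (A 1 k) (ν k))

  climb-steps : ∀ k → 3 ≤ k →
    Transforms PairStrict (applyAll (map (λ j → fPow j (bottom k + top k)) (fromTo 4 k))) (tableauWith k 4) (tableauWith k (suc k))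
  climb-steps k@(suc k″) 3≤k =
    climb (top k) (bottom k) 3 k (++⁺ (All-replicate α (s≤s (s≤s z≤n))) (All-replicate (P k) (s≤s (s≤s (s≤s z≤n)))))
          (++⁺ (All-replicate (β k) (s≤s (s≤s (s≤s z≤n)))) (All-replicate (S k″) ≤-refl))
          (blocks-above top (suc k) (n ∸ k) (n<1+n k)) (blocks-above bottom (suc k) (n ∸ k) (n<1+n k))
          (≤⇒≤‴ (s≤s 3≤k))

  raise-steps : ∀ k → 2 ≤ k → k ≤ n →
    Transforms PairStrict (applyAll (map (λ j → fPow j (bottom k + top k)) (fromTo 3 k))) (afterD k) (tableau k)
  raise-steps 1 (s≤s ()) _
  raise-steps 2 _ 2≤n = transforms-≡ (trans afterD-2 (sym (tableau-unfold 2 2≤n))) transforms-just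
  raise-steps k@(suc (suc (suc _))) _ k≤n =
    transforms-∷ {gs = map (λ j → fPow j (bottom k + top k)) (fromTo 4 k)} (f₃-step k 3≤k)
      (transforms-≡ (sym (tableau-unfold k k≤n)) (climb-steps k 3≤k))
    where
    3≤k : 3 ≤ k
    3≤k = s≤s (s≤s (s≤s z≤n))

  X-step : ∀ k → 2 ≤ k → k ≤ n → Transforms PairStrict (Xop 2 A k) (tableau (suc k)) (tableau k)
  X-step k 2≤k k≤n = transforms-∷ {gs = map (λ j → fPow j (cc 2 A k)) (fromTo 3 k)} (D-step k 2≤k k≤n)
    (subst (λ c → Transforms PairStrict (applyAll (map (λ j → fPow j c) (fromTo 3 k))) (afterD k) (tableau k))
           (sym (cc≡bottom+top k k≤n)) (raise-steps k 2≤k k≤n))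

  module _ (2≤n : 2 ≤ n) where

    d : ℕ
    d = sumN 2 n (A 1)

    d≡S : d ≡ S n
    d≡S = sumN-2≡S n (≤-trans (s≤s z≤n) 2≤n)

    d≤m : d ≤ m
    d≤m = subst (_≤ m) (sym d≡S) (≤-trans (m≤m+n (S n) (N n)) (S+N≤m n 2≤n ≤-refl))

    m≡m∸d+d : m ≡ m ∸ d + d
    m≡m∸d+d = sym (m∸n+n≡m d≤m)

    G-result : row 1 [] (m ∸ d) (0 + d) [] ∷ row 1 [] 0 (m ∸ d + 0) (replicate d 3 ++ []) ∷ [] ≡ tableau (suc n)
    G-result = cong₂ (λ r₁ r₂ → r₁ ∷ r₂ ∷ [])
      (cong₃ (λ a b t → replicate a 1 ++ replicate b 2 ++ t) (cong (m ∸_) d≡S) d≡P (sym (blocks-end top n)))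
      (cong₃ (λ a b t → replicate a 2 ++ replicate b 3 ++ t) m∸d+0≡β d≡S (sym (blocks-end bottom n)))
      where
      cong₃ : ∀ (f : ℕ → ℕ → List ℕ → List ℕ) {a a′ b b′ t t′} → a ≡ a′ → b ≡ b′ → t ≡ t′ → f a b t ≡ f a′ b′ t′
      cong₃ f refl refl refl = refl
      d≡P : d ≡ P (suc n)
      d≡P = begin
        d                               ≡⟨ d≡S ⟩
        S n                             ≡⟨ sym (+-identityʳ (S n)) ⟩
        S n + 0                         ≡⟨ cong (S n +_) (sym a₁,₁₊ₙ≡0) ⟩
        S n + A 1 (suc n)               ≡⟨ sym (S-suc n) ⟩
        S (suc n)                       ≡⟨ sym (+-identityʳ (S (suc n))) ⟩
        S (suc n) + 0                   ≡⟨ cong (λ z → S (suc n) + proj₁ (UV A n z)) (sym (m≤n⇒m∸n≡0 (n≤1+n n))) ⟩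
        P (suc n)                       ∎
        where open ≡-Reasoning
      m∸d+0≡β : m ∸ d + 0 ≡ β (suc n)
      m∸d+0≡β = trans (+-identityʳ (m ∸ d))
        (cong (m ∸_) (trans d≡S (trans (sym (+-identityʳ (S n))) (cong (S n +_) (sym (sumN-empty {suc n} {n} ν ≤-refl))))))

    G-step : Transforms PairStrict (Gop 2 n A) (T0 2 m) (tableau (suc n))
    G-step = transforms-∷ {gs = fPow 1 d ∷ []}
      (subst (λ c → Transforms PairStrict (fPow 2 c) (T0 2 m) T₁) (+-identityʳ d)
        (transforms-cong (cong₂ (λ r₁ r₂ → r₁ ∷ r₂ ∷ []) (++-identityʳ (replicate m 1)) (++-identityʳ (replicate m 2))) refl
          (fPow-two-rows {pre₁ = replicate m 1} {[]} {[]} {[]} (All-replicate m (s≤s (s≤s z≤n))) [] [] []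
                         0 0 (m ∸ d) 0 0 d refl m≡m∸d+d z≤n (inj₂ z≤n))))
      (transforms-∷ {gs = []}
        (transforms-≡ G-result
          (fPow-two-rows {pre₁ = []} {[]} {[]} {replicate d 3 ++ []} [] [] [] (++⁺ (All-replicate d ≤-refl) [])
                         (m ∸ d) 0 0 (m ∸ d) d 0 m≡m∸d+d refl ≤-refl (inj₁ refl)))
        transforms-just)
      where
      T₁ : Tableau
      T₁ = (replicate m 1 ++ []) ∷ (replicate (m ∸ d) 2 ++ replicate d 3 ++ []) ∷ []

    T0-strict : PairStrict (T0 2 m)
    T0-strict zero    = ≤-trans (≤-reflexive (atMost-none (All-replicate {1 <_} m ≤-refl))) z≤n
    T0-strict (suc v) = ≤-reflexive (begin
      atMost (suc (suc v)) (replicate m 2)   ≡⟨ atMost-all (All-replicate {_≤ suc (suc v)} m (s≤s (s≤s z≤n))) ⟩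
      length (replicate m 2)                 ≡⟨ trans (length-replicate m) (sym (length-replicate m)) ⟩
      length (replicate m 1)                 ≡⟨ sym (atMost-all (All-replicate {_≤ suc v} m (s≤s z≤n))) ⟩
      atMost (suc v) (replicate m 1)         ∎)
      where open ≡-Reasoning

    tableaux : ∀ k → 2 ≤ k → k ≤ suc n → Tk 2 n m A k ≡ just (tableau k) × PairStrict (tableau k)
    tableaux = Tk-descent 2 n m A tableau 2 G-step X-step T0-strict

    module _ (k : ℕ) (2≤k : 2 ≤ k) (k≤n : k ≤ n) where

      computes : Tk 2 n m A k ≡ just (tableau k)
      computes = proj₁ (tableaux k 2≤k (m≤n⇒m≤1+n k≤n))

      k+[1+n∸k]≡1+n : k + (suc n ∸ k) ≡ suc n
      k+[1+n∸k]≡1+n = m+[n∸m]≡n (m≤n⇒m≤1+n k≤n)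

      ssyt : IsSSYT 2 n m (tableau k)
      ssyt = ssyt-two-rows length-top length-bottom ascending-top ascending-bottom bounded-top bounded-bottom
                           (proj₂ (tableaux k 2≤k (m≤n⇒m≤1+n k≤n)))
        where
        lengths : map length (tableau k) ≡ map length (T0 2 m)
        lengths = Tk-shape 2 n m A k computes
        length-top : length (rowTop k) ≡ m
        length-top = trans (proj₁ (∷-injective lengths)) (length-replicate m)
        length-bottom : length (rowBottom k) ≡ m
        length-bottom = trans (proj₁ (∷-injective (proj₂ (∷-injective lengths)))) (length-replicate m)
        ascending-top : AscendingFrom 1 (rowTop k)
        ascending-top = ascending-replicate-++ α ≤-refl (ascending-replicate-++ (P k) (n≤1+n 1)
                          (ascending-weaken (m≤n⇒m≤1+n 2≤k) (ascending-blocks top k (suc n ∸ k))))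
        ascending-bottom : AscendingFrom 1 (rowBottom k)
        ascending-bottom = ascending-replicate-++ (β k) (n≤1+n 1) (ascending-replicate-++ (S (k ∸ 1)) (n≤1+n 2)
                             (ascending-weaken (s≤s 2≤k) (ascending-blocks bottom k (suc n ∸ k))))
        blocks-bounded : ∀ f → All (_≤ suc n) (blocks f k (suc n ∸ k))
        blocks-bounded f = subst (λ b → All (_≤ b) (blocks f k (suc n ∸ k))) k+[1+n∸k]≡1+n (blocks-≤ f k _)
        bounded-top : All (_≤ suc n) (rowTop k)
        bounded-top = ++⁺ (All-replicate α (s≤s z≤n)) (++⁺ (All-replicate (P k) (m≤n⇒m≤1+n 2≤n)) (blocks-bounded top))
        bounded-bottom : All (_≤ suc n) (rowBottom k)
        bounded-bottom = ++⁺ (All-replicate (β k) (m≤n⇒m≤1+n 2≤n)) (++⁺ (All-replicate (S (k ∸ 1)) (s≤s 2≤n)) (blocks-bounded bottom))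

      count-blocks-in : ∀ f {w} → k < w → w ≤ suc n → count w (blocks f k (suc n ∸ k)) ≡ f (w ∸ 1)
      count-blocks-in f {w} k<w w≤1+n = count-blocks f k (suc n ∸ k) k<w (subst (w ≤_) (sym k+[1+n∸k]≡1+n) w≤1+n)

      count-top-1 : count 1 (rowTop k) ≡ α
      count-top-1 = trans (count-replicate-++ 1 α _)
        (trans (cong (α +_) (trans (count-replicate-≢-++ (P k) _ (λ ())) (count-blocks-≤ top k (suc n ∸ k) (≤-trans (n≤1+n 1) 2≤k))))
               (+-identityʳ α))

      count-top-2 : count 2 (rowTop k) ≡ P k
      count-top-2 = trans (count-replicate-≢-++ α _ (λ ()))
        (trans (count-replicate-++ 2 (P k) _) (trans (cong (P k +_) (count-blocks-≤ top k (suc n ∸ k) 2≤k)) (+-identityʳ (P k))))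

      count-top-≥3 : ∀ w → 3 ≤ w → count w (rowTop k) ≡ count w (blocks top k (suc n ∸ k))
      count-top-≥3 w 3≤w = trans (count-replicate-≢-++ α _ (λ 1≡w → <⇒≢ (≤-trans (s≤s (s≤s z≤n)) 3≤w) 1≡w))
                                 (count-replicate-≢-++ (P k) _ (λ 2≡w → <⇒≢ 3≤w 2≡w))

      count-bottom-2 : count 2 (rowBottom k) ≡ β k
      count-bottom-2 = trans (count-replicate-++ 2 (β k) _)
        (trans (cong (β k +_) (trans (count-replicate-≢-++ (S (k ∸ 1)) _ (λ ())) (count-blocks-≤ bottom k (suc n ∸ k) 2≤k)))
               (+-identityʳ (β k)))

      count-bottom-3 : count 3 (rowBottom k) ≡ S (k ∸ 1) + count 3 (blocks bottom k (suc n ∸ k))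
      count-bottom-3 = trans (count-replicate-≢-++ (β k) _ (λ ())) (count-replicate-++ 3 (S (k ∸ 1)) _)

      count-bottom-≥4 : ∀ w → 4 ≤ w → count w (rowBottom k) ≡ count w (blocks bottom k (suc n ∸ k))
      count-bottom-≥4 w 4≤w = trans (count-replicate-≢-++ (β k) _ (λ 2≡w → <⇒≢ (≤-trans (s≤s (s≤s (s≤s z≤n))) 4≤w) 2≡w))
                                    (count-replicate-≢-++ (S (k ∸ 1)) _ (λ 3≡w → <⇒≢ 4≤w 3≡w))

      count-top : ∀ t → k < t → t ≤ n → count t (rowTop k) ≡ top (t ∸ 1)
      count-top t k<t t≤n = trans (count-top-≥3 t (≤-trans (s≤s 2≤k) k<t)) (count-blocks-in top k<t (m≤n⇒m≤1+n t≤n))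

      count-bottom : ∀ t → k ≤ t → t ≤ n → count (suc t) (rowBottom k) ≡ bottom t
      count-bottom t k≤t t≤n with t ≟ 2
      ... | yes refl = begin
        count 3 (rowBottom k)                                   ≡⟨ count-bottom-3 ⟩
        S (k ∸ 1) + count 3 (blocks bottom k (suc n ∸ k))       ≡⟨ cong₂ _+_ (trans (cong (λ z → S (z ∸ 1)) (≤-antisym k≤t 2≤k)) S-1)
                                                                            (count-blocks-in bottom (s≤s k≤t) (s≤s 2≤n)) ⟩
        bottom 2                                                ∎
        where open ≡-Reasoning
      ... | no t≢2 = trans (count-bottom-≥4 (suc t) (s≤s (≤∧≢⇒< (≤-trans 2≤k k≤t) (≢-sym t≢2))))
                           (count-blocks-in bottom (s≤s k≤t) (s≤s t≤n))

      count-bottom-3-settled : 3 ≤ k → count 3 (rowBottom k) ≡ S (k ∸ 1)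
      count-bottom-3-settled 3≤k =
        trans count-bottom-3 (trans (cong (S (k ∸ 1) +_) (count-blocks-≤ bottom k (suc n ∸ k) 3≤k)) (+-identityʳ _))

      module _ where
        open import Data.Integer as ℤ using (ℤ; +_; -_; _-_; _*_)
        import Data.Integer.Properties as ℤᵖ

        χΣ≡-ν : ∀ j → Chi A n j * Sig A n j ≡ - (+ ν j)
        χΣ≡-ν j = proj₂ (SC-UV A n (n ∸ j))

        [1-χ]Σ≡u : ∀ j → (+ 1 - Chi A n j) * Sig A n j ≡ + u j
        [1-χ]Σ≡u j = proj₁ (SC-UV A n (n ∸ j))

        bounded : ∀ {t} → t ≤ n ∸ 2 + 2 → t ≤ n
        bounded {t} = subst (t ≤_) (m∸n+n≡m 2≤n)

        entry-1-1 : ∀ s t → InDom 2 n s t → Case1 2 n k s t → + mat (tableau k) s t ≡ + m - + sumN 2 n (λ j → A 1 j)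
        entry-1-1 _ _ _ (refl , refl) = trans (cong +_ count-top-1) (trans (pos-∸ (subst (_≤ m) d≡S d≤m)) (cong (λ z → + m - + z) (sym d≡S)))

        entry-1-2 : ∀ s t → InDom 2 n s t → Case2 2 n k s t →
          + mat (tableau k) s t ≡ + sumN 2 k (λ j → A 1 j) ℤ.+ (+ 1 - Chi A n k) * Sig A n k
        entry-1-2 _ _ _ (refl , refl) = trans (cong +_ count-top-2)
          (trans (ℤᵖ.pos-+ (S k) (u k)) (cong₂ ℤ._+_ (cong +_ (sym (sumN-2≡S k (≤-trans (n≤1+n 1) 2≤k)))) (sym ([1-χ]Σ≡u k))))

        entry-2-1 : ∀ s t → InDom 2 n s t → Case3 2 n k s t →
          + mat (tableau k) s t ≡ (+ m - + sumN 2 n (λ j → A 1 j)) ℤ.+ sumZ k n (λ j → Chi A n j * Sig A n j)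
        entry-2-1 _ _ _ (refl , refl) = begin
          + count 2 (rowBottom k)                    ≡⟨ cong +_ count-bottom-2 ⟩
          + β k                                      ≡⟨ pos-∸ (S+N≤m k 2≤k k≤n) ⟩
          + m - + (S n + N k)                        ≡⟨ cong (λ z → + m ℤ.+ - z) (ℤᵖ.pos-+ (S n) (N k)) ⟩
          + m ℤ.+ - (+ S n ℤ.+ + N k)                ≡⟨ cong (ℤ._+_ (+ m)) (ℤᵖ.neg-distrib-+ (+ S n) (+ N k)) ⟩
          + m ℤ.+ (- + S n ℤ.+ - + N k)              ≡⟨ sym (ℤᵖ.+-assoc (+ m) (- + S n) (- + N k)) ⟩
          (+ m - + S n) ℤ.+ - + N k                  ≡⟨ cong₂ (λ a b → (+ m - + a) ℤ.+ b) (sym d≡S) (sym (sumZ-neg k n χΣ≡-ν)) ⟩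
          _                                          ∎
          where open ≡-Reasoning

        entry-2-2 : ∀ s t → InDom 2 n s t → Case4 2 n k s t → + mat (tableau k) s t ≡ + sumN 2 (k ∸ 1) (λ j → A 1 j)
        entry-2-2 _ _ _ (refl , refl , 3≤k) =
          cong +_ (trans (count-bottom-3-settled 3≤k) (sym (sumN-2≡S (k ∸ 1) (∸-monoˡ-≤ 1 (≤-trans (n≤1+n 2) 3≤k)))))

        entry-1-t : ∀ s t → InDom 2 n s t → Case5 2 n k s t →
          + mat (tableau k) s t ≡ + A 2 (t ∸ 1) ℤ.+ Chi A n (t ∸ 1) * Sig A n (t ∸ 1)
        entry-1-t _ t _ (refl , k+1≤t , t≤n) = begin
          + count t (rowTop k)                 ≡⟨ cong +_ (count-top t (subst (_≤ t) (+-comm k 1) k+1≤t) t≤n) ⟩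
          + (A 2 (t ∸ 1) ∸ ν (t ∸ 1))          ≡⟨ pos-∸ (ν≤A₂ (t ∸ 1) (≤-trans (m∸n≤m t 1) t≤n)) ⟩
          + A 2 (t ∸ 1) - + ν (t ∸ 1)          ≡⟨ cong (ℤ._+_ (+ A 2 (t ∸ 1))) (sym (χΣ≡-ν (t ∸ 1))) ⟩
          _                                    ∎
          where open ≡-Reasoning

        entry-2-t : ∀ s t → InDom 2 n s t → Case6 2 n k s t →
          + mat (tableau k) s t ≡ + A 1 (t + 2 ∸ 2) - Chi A n (t + 2 ∸ 2) * Sig A n (t + 2 ∸ 2)
        entry-2-t _ t _ (refl , k≤t , t≤n) rewrite m+n∸n≡m t 2 | m+n∸n≡m k 2 | m+n∸n≡m n 2 = begin
          + count (suc t) (rowBottom k)          ≡⟨ cong +_ (count-bottom t k≤t t≤n) ⟩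
          + (A 1 t + ν t)                        ≡⟨ ℤᵖ.pos-+ (A 1 t) (ν t) ⟩
          + A 1 t ℤ.+ + ν t                      ≡⟨ cong (ℤ._+_ (+ A 1 t)) (sym (trans (cong -_ (χΣ≡-ν t)) (ℤᵖ.neg-involutive (+ ν t)))) ⟩
          _                                      ∎
          where open ≡-Reasoning

        others : ∀ s t → InDom 2 n s t →
          ¬ (Case1 2 n k s t ⊎ Case2 2 n k s t ⊎ Case3 2 n k s t ⊎ Case4 2 n k s t ⊎ Case5 2 n k s t ⊎ Case6 2 n k s t) →
          mat (tableau k) s t ≡ 0
        others 0 _ (() , _) _
        others (suc (suc (suc _))) _ (_ , s≤s (s≤s ()) , _) _
        others _ 0 (_ , _ , () , _) _
        others 1 1 _ ¬cases = ⊥-elim (¬cases (inj₁ (refl , refl)))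
        others 1 2 _ ¬cases = ⊥-elim (¬cases (inj₂ (inj₁ (refl , refl))))
        others 1 t@(suc (suc (suc _))) (_ , _ , _ , t≤) ¬cases with k <? t
        ... | yes k<t = ⊥-elim (¬cases (inj₂ (inj₂ (inj₂ (inj₂ (inj₁ (refl , subst (_≤ t) (+-comm 1 k) k<t , bounded t≤)))))))
        ... | no k≮t  = trans (count-top-≥3 t (s≤s (s≤s (s≤s z≤n)))) (count-blocks-≤ top k (suc n ∸ k) (≮⇒≥ k≮t))
        others 2 1 _ ¬cases = ⊥-elim (¬cases (inj₂ (inj₂ (inj₁ (refl , refl)))))
        others 2 2 _ ¬cases with 3 ≤? k
        ... | yes 3≤k = ⊥-elim (¬cases (inj₂ (inj₂ (inj₂ (inj₁ (refl , refl , 3≤k))))))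
        ... | no 3≰k  = ⊥-elim (¬cases (inj₂ (inj₂ (inj₂ (inj₂ (inj₂ (refl , subst (_≤ 2) (sym (m+n∸n≡m k 2)) (≤-pred (≰⇒> 3≰k)) ,
                                                                             subst (2 ≤_) (sym (m+n∸n≡m n 2)) 2≤n)))))))
        others 2 t@(suc (suc (suc _))) (_ , _ , _ , t≤) ¬cases with k ≤? t
        ... | yes k≤t = ⊥-elim (¬cases (inj₂ (inj₂ (inj₂ (inj₂ (inj₂ (refl , subst (_≤ t) (sym (m+n∸n≡m k 2)) k≤t ,
                                                                           subst (t ≤_) (sym (m+n∸n≡m n 2)) (bounded t≤))))))))
        ... | no k≰t  = trans (count-bottom-≥4 (suc t) (s≤s (s≤s (s≤s (s≤s z≤n))))) (count-blocks-≤ bottom k (suc n ∸ k) (≰⇒> k≰t))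

        matrix : MatrixFormula 2 n m A k (tableau k)
        matrix = entry-1-1 , entry-1-2 , entry-2-1 , entry-2-2 , entry-1-t , entry-2-t , others

-- The case i = 1

module OneRow (n m : ℕ) (A : Array) (a₂≡0 : ∀ q → A 2 q ≡ 0) (paths : ∀ (β : DyckPath 1 n) → pathSum A β ≤ m) (1≤n : 1 ≤ n) where

  S : ℕ → ℕ
  S k = sumN 1 k (A 1)

  S-suc : ∀ k → S (suc k) ≡ S k + A 1 (suc k)
  S-suc k = sumN-snoc (A 1) (s≤s z≤n)

  S≤m : S n ≤ m
  S≤m = subst (_≤ m) (pathSum-column A (≤⇒≤‴ 1≤n)) (paths (column (≤⇒≤‴ 1≤n)))

  α : ℕ
  α = m ∸ S n

  onlyRow : ℕ → List ℕ
  onlyRow k = replicate α 1 ++ replicate (S (k ∸ 1)) 2 ++ blocks (A 1) k (suc n ∸ k)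

  tableau : ℕ → Tableau
  tableau k = onlyRow k ∷ []

  G-step : Transforms (λ _ → ⊤) (Gop 1 n A) (T0 1 m) (tableau (suc n))
  G-step = transforms-∷ {g = fPow 1 (S n)} {gs = []}
    (transforms-⊤ (trans (cong (fPow 1 (S n)) (cong (_∷ []) (sym (++-identityʳ (replicate m 1)))))
                  (trans (fPow-row α 0 (S n) [] [] (sym (m∸n+n≡m S≤m)))
                         (cong (λ t → just ((replicate α 1 ++ replicate (S n) 2 ++ t) ∷ [])) (sym (blocks-end (A 1) n))))))
    transforms-just

  -- tableau k, except that the block of letters k+1 still consists of letters j
  tableauWith : ℕ → ℕ → Tableau
  tableauWith k j = ((replicate α 1 ++ replicate (S (k ∸ 1)) 2) ++ replicate (A 1 k) j ++ blocks (A 1) (suc k) (n ∸ k)) ∷ []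

  tableau-unfold : ∀ k → k ≤ n → tableau k ≡ tableauWith k (suc k)
  tableau-unfold k k≤n rewrite blocks-unfold (A 1) k≤n = cong (_∷ []) (sym (++-assoc (replicate α 1) _ _))

  f₂-step : ∀ k → 2 ≤ k → Transforms (λ _ → ⊤) (fPow 2 (A 1 k)) (tableau (suc k)) (tableauWith k 3)
  f₂-step k@(suc k′) 2≤k = transforms-⊤ (trans
    (fPow-row (S k′) 0 (A 1 k) (All-replicate α ≤-refl) (blocks-above (A 1) (suc k) (n ∸ k) (s≤s 2≤k)) (S-suc k′))
    (cong (λ r → just (r ∷ [])) (sym (++-assoc (replicate α 1) _ _))))

  X-step : ∀ k → 2 ≤ k → k ≤ n → Transforms (λ _ → ⊤) (Xop 1 A k) (tableau (suc k)) (tableau k)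
  X-step k@(suc k′) 2≤k k≤n = transforms-∷ {g = just} {gs = map (λ j → fPow j (cc 1 A k)) (fromTo 2 k)} transforms-just
    (subst (λ c → Transforms (λ _ → ⊤) (applyAll (map (λ j → fPow j c) (fromTo 2 k))) (tableau (suc k)) (tableau k))
           (sym (+-identityʳ (A 1 k)))
      (subst (λ L → Transforms (λ _ → ⊤) (applyAll (map (λ j → fPow j (A 1 k)) L)) (tableau (suc k)) (tableau k))
             (sym (fromTo-cons 2≤k))
        (transforms-∷ {gs = map (λ j → fPow j (A 1 k)) (fromTo 3 k)} (f₂-step k 2≤k)
          (transforms-≡ (sym (tableau-unfold k k≤n))
            (climb-row (A 1 k) 2 k (++⁺ (All-replicate α (s≤s (s≤s z≤n))) (All-replicate (S k′) ≤-refl))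
                       (blocks-above (A 1) (suc k) (n ∸ k) (n<1+n k)) (≤⇒≤‴ (s≤s 2≤k)))))))

  tableaux : ∀ k → 2 ≤ k → k ≤ suc n → Tk 1 n m A k ≡ just (tableau k) × ⊤
  tableaux = Tk-descent 1 n m A tableau 2 G-step X-step tt

  ν≡0 : ∀ d → proj₂ (UV A n d) ≡ 0
  ν≡0 zero    = a₂≡0 n
  ν≡0 (suc d) rewrite a₂≡0 (n ∸ suc d) = 0∸n≡0 (A 1 (suc (n ∸ suc d)) + proj₁ (UV A n d))

  module _ (k : ℕ) (2≤k : 2 ≤ k) (k≤n : k ≤ n) where

    computes : Tk 1 n m A k ≡ just (tableau k)
    computes = proj₁ (tableaux k 2≤k (m≤n⇒m≤1+n k≤n))

    k+[1+n∸k]≡1+n : k + (suc n ∸ k) ≡ suc n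
    k+[1+n∸k]≡1+n = m+[n∸m]≡n (m≤n⇒m≤1+n k≤n)

    ssyt : IsSSYT 1 n m (tableau k)
    ssyt = ssyt-one-row (trans (proj₁ (∷-injective (Tk-shape 1 n m A k computes))) (length-replicate m))
      (ascending-replicate-++ α ≤-refl (ascending-replicate-++ (S (k ∸ 1)) (n≤1+n 1)
        (ascending-weaken (m≤n⇒m≤1+n 2≤k) (ascending-blocks (A 1) k (suc n ∸ k)))))
      (++⁺ (All-replicate α (s≤s z≤n)) (++⁺ (All-replicate (S (k ∸ 1)) (s≤s 1≤n))
        (subst (λ b → All (_≤ b) (blocks (A 1) k (suc n ∸ k))) k+[1+n∸k]≡1+n (blocks-≤ (A 1) k (suc n ∸ k)))))

    count-1 : count 1 (onlyRow k) ≡ α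
    count-1 = trans (count-replicate-++ 1 α _)
      (trans (cong (α +_) (trans (count-replicate-≢-++ (S (k ∸ 1)) _ (λ ())) (count-blocks-≤ (A 1) k (suc n ∸ k) (≤-trans (n≤1+n 1) 2≤k))))
             (+-identityʳ α))

    count-2 : count 2 (onlyRow k) ≡ S (k ∸ 1)
    count-2 = trans (count-replicate-≢-++ α _ (λ ()))
      (trans (count-replicate-++ 2 (S (k ∸ 1)) _) (trans (cong (S (k ∸ 1) +_) (count-blocks-≤ (A 1) k (suc n ∸ k) 2≤k)) (+-identityʳ _)))

    count-≥3 : ∀ w → 3 ≤ w → count w (onlyRow k) ≡ count w (blocks (A 1) k (suc n ∸ k))
    count-≥3 w 3≤w = trans (count-replicate-≢-++ α _ (λ 1≡w → <⇒≢ (≤-trans (s≤s (s≤s z≤n)) 3≤w) 1≡w))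
                           (count-replicate-≢-++ (S (k ∸ 1)) _ (λ 2≡w → <⇒≢ 3≤w 2≡w))

    count-at : ∀ t → k < t → t ≤ suc n → count t (onlyRow k) ≡ A 1 (t ∸ 1)
    count-at t k<t t≤1+n = trans (count-≥3 t (≤-trans (s≤s 2≤k) k<t))
      (count-blocks (A 1) k (suc n ∸ k) k<t (subst (t ≤_) (sym k+[1+n∸k]≡1+n) t≤1+n))

    module _ where
      open import Data.Integer as ℤ using (ℤ; +_; -_; _-_; _*_)
      import Data.Integer.Properties as ℤᵖ

      χΣ≡0 : ∀ j → Chi A n j * Sig A n j ≡ - (+ 0)
      χΣ≡0 j = trans (proj₂ (SC-UV A n (n ∸ j))) (cong (λ v → - (+ v)) (ν≡0 (n ∸ j)))

      bounded : ∀ {t} → t ≤ n ∸ 1 + 2 → t ≤ suc n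
      bounded {t} = subst (t ≤_) (trans (+-comm (n ∸ 1) 2) (cong suc (m+[n∸m]≡n 1≤n)))

      entry-1-1 : ∀ s t → InDom 1 n s t → Case3 1 n k s t →
        + mat (tableau k) s t ≡ (+ m - + sumN 1 n (λ j → A 1 j)) ℤ.+ sumZ k n (λ j → Chi A n j * Sig A n j)
      entry-1-1 _ _ _ (refl , refl) = begin
        + count 1 (onlyRow k)        ≡⟨ cong +_ count-1 ⟩
        + α                          ≡⟨ pos-∸ S≤m ⟩
        + m - + S n                  ≡⟨ sym (ℤᵖ.+-identityʳ _) ⟩
        (+ m - + S n) ℤ.+ - (+ 0)
          ≡⟨ cong (ℤ._+_ (+ m - + S n)) (sym (trans (sumZ-neg k n {f = λ _ → 0} χΣ≡0) (cong (λ z → - (+ z)) (sumN-zeros k n)))) ⟩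
        _                            ∎
        where open ≡-Reasoning

      entry-1-2 : ∀ s t → InDom 1 n s t → Case4 1 n k s t → + mat (tableau k) s t ≡ + sumN 1 (k ∸ 1) (λ j → A 1 j)
      entry-1-2 _ _ _ (refl , refl , _) = cong +_ count-2

      entry-1-t : ∀ s t → InDom 1 n s t → Case6 1 n k s t →
        + mat (tableau k) s t ≡ + A 1 (t + 1 ∸ 2) - Chi A n (t + 1 ∸ 2) * Sig A n (t + 1 ∸ 2)
      entry-1-t _ t _ (refl , k+1≤t , t≤1+n) rewrite +-comm t 1 | +-comm k 2 | +-comm n 2 = begin
        + count t (onlyRow k)                   ≡⟨ cong +_ (count-at t k+1≤t t≤1+n) ⟩
        + A 1 (t ∸ 1)                           ≡⟨ sym (ℤᵖ.+-identityʳ _) ⟩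
        + A 1 (t ∸ 1) ℤ.+ - (+ 0)               ≡⟨ cong (λ z → + A 1 (t ∸ 1) - z) (sym (χΣ≡0 (t ∸ 1))) ⟩
        _                                       ∎
        where open ≡-Reasoning

      others : ∀ s t → InDom 1 n s t →
        ¬ (Case1 1 n k s t ⊎ Case2 1 n k s t ⊎ Case3 1 n k s t ⊎ Case4 1 n k s t ⊎ Case5 1 n k s t ⊎ Case6 1 n k s t) →
        mat (tableau k) s t ≡ 0
      others 0 _ (() , _) _
      others (suc (suc _)) _ (_ , s≤s () , _) _
      others _ 0 (_ , _ , () , _) _
      others 1 1 _ ¬cases = ⊥-elim (¬cases (inj₂ (inj₂ (inj₁ (refl , refl)))))
      others 1 2 _ ¬cases = ⊥-elim (¬cases (inj₂ (inj₂ (inj₂ (inj₁ (refl , refl , 2≤k))))))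
      others 1 t@(suc (suc (suc _))) (_ , _ , _ , t≤) ¬cases with k <? t
      ... | yes k<t = ⊥-elim (¬cases (inj₂ (inj₂ (inj₂ (inj₂ (inj₂ (refl , subst (λ z → z ∸ 1 ≤ t) (+-comm 2 k) k<t ,
                                                                         subst (λ z → t ≤ z ∸ 1) (+-comm 2 n) (bounded t≤))))))))
      ... | no k≮t  = trans (count-≥3 t (s≤s (s≤s (s≤s z≤n)))) (count-blocks-≤ (A 1) k (suc n ∸ k) (≮⇒≥ k≮t))

      matrix : MatrixFormula 1 n m A k (tableau k)
      matrix = (λ { _ _ (() , _) (refl , _) }) , (λ { _ _ (() , _) (refl , _) }) , entry-1-1 , entry-1-2 ,
               (λ { _ _ (() , _) (refl , _) }) , entry-1-t , others

theorem4p3 : (n i m : ℕ) (A : Array) (k : ℕ) →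
    4 ≤ n → (i ≡ 1 ⊎ i ≡ 2) → 1 ≤ m → InB i n m A →
    2 ≤ k → k ≤ n →
    ∃ λ T → Tk i n m A k ≡ just T × IsSSYT i n m T × MatrixFormula i n m A k T
theorem4p3 n .1 m A k 4≤n (inj₁ refl) _ (vanishes , paths) 2≤k k≤n =
  tableau k , computes k 2≤k k≤n , ssyt k 2≤k k≤n , matrix k 2≤k k≤n
  where
  open OneRow n m A (λ q → vanishes 2 q (inj₂ (inj₁ (s≤s (s≤s z≤n))))) paths (≤-trans (s≤s z≤n) 4≤n)
theorem4p3 n .2 m A k 4≤n (inj₂ refl) _ (vanishes , paths) 2≤k k≤n =
  tableau k , computes 2≤n k 2≤k k≤n , ssyt 2≤n k 2≤k k≤n , matrix 2≤n k 2≤k k≤n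
  where
  open TwoRows n m A (vanishes 1 1 (inj₂ (inj₂ (inj₁ (s≤s (s≤s z≤n)))))) (vanishes 1 (suc n) (inj₂ (inj₂ (inj₂ ≤-refl)))) paths
  2≤n : 2 ≤ n
  2≤n = ≤-trans (s≤s (s≤s z≤n)) 4≤n
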